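{- Let $n\ge 1$ and $k\ge 1$ be integers and let $L(X)=\sum_{i=0}^k b_iX^{2^i}$ with $b_i\in\mathbb F_2$ for all $i$ and $b_k=1$. Let $A$ be the $k\times k$ matrix over $\mathbb F_2$ whose entries are $A_{i+1,i}=1$ for $1\le i\le k-1$, $A_{i+1,k}=b_i$ for $0\le i\le k-1$, and all other entries $0$ (the companion matrix). Then $L(X)$ splits completely over $\mathbb F_{2^n}$ and has simple zeros (i.e. $L(X)=\prod_{u\in E_k}(X+u)$ for some $k$-dimensional $\mathbb F_2$-linear subspace $E_k$ of $\mathbb F_{2^n}$) if and only if $A^n=I_k$; this is equivalent to the condition that the polynomial $P(X)=\sum_{i=0}^k b_iX^i\in\mathbb F_2[X]$ divides $X^n+1$. Consequently, if $X^n+1$ has a factor in $\mathbb F_2[X]$ of the form $X^k+a_{k-1}X^{k-1}+\cdots+a_2X^2+a_0$ (i.e. with zero coefficient of $X$), then $F_{\mathrm{inv}}$ is not $k$th order sum-free.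
   Context: $F_{\mathrm{inv}}:\mathbb F_{2^n}\to\mathbb F_{2^n}$ is defined by $F_{\mathrm{inv}}(x)=x^{2^n-2}$ (so $F_{\mathrm{inv}}(x)=x^{ -1}$ for $x\ne0$ and $F_{\mathrm{inv}}(0)=0$). A function $F:\mathbb F_{2^n}\to\mathbb F_{2^n}$ is called $k$th order sum-free if $\sum_{x\in A}F(x)\ne 0$ for every $k$-dimensional affine $\mathbb F_2$-subspace $A$ of $\mathbb F_{2^n}$. $I_k$ denotes the $k\times k$ identity matrix. -}

module Defs where

open import Data.Nat using (ℕ; zero; suc; _∸_; _^_)
open import Data.Bool using (Bool; true; false; if_then_else_; _xor_; _∧_)
open import Data.Fin using (Fin; zero; suc; toℕ; inject₁; fromℕ)
open import Data.Fin.Properties using (_≟_)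
open import Data.List using (List; []; _∷_; replicate; _++_; foldr; map; concatMap)
open import Data.Vec using (Vec; []; _∷_; allFin; toList; tabulate)
open import Data.Product using (Σ; _×_; _,_)
open import Relation.Binary.PropositionalEquality using (_≡_; _≢_)
open import Relation.Nullary using (yes; no; ¬_)
open import Function.Bundles using (_↔_)
open import Algebra.Structures using (IsCommutativeRing)

-- A finite field with 2^n elements (all such fields are isomorphic,
-- so quantifying over all of them is the same as talking about F_{2^n}).

record FiniteField (n : ℕ) : Set₁ where
  field
    Carrier : Set
    _+_ _*_ : Carrier → Carrier → Carrier
    -_      : Carrier → Carrier
    0# 1#   : Carrier
    isCommutativeRing : IsCommutativeRing _≡_ _+_ _*_ -_ 0# 1#
    0≢1     : 0# ≢ 1#
    inverse : (x : Carrier) → x ≢ 0# → Σ Carrier (λ y → x * y ≡ 1#)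
    card    : Fin (2 ^ n) ↔ Carrier

-- Univariate polynomials over a coefficient type, as coefficient lists
-- (lowest degree first); equality is compared coefficientwise.

module Poly {A : Set} (0a : A) (_⊕_ _⊗_ : A → A → A) where

  add : List A → List A → List A
  add []       q        = q
  add p        []       = p
  add (a ∷ p)  (b ∷ q)  = (a ⊕ b) ∷ add p q

  scale : A → List A → List A
  scale c = map (c ⊗_)

  mul : List A → List A → List A
  mul []      q = []
  mul (a ∷ p) q = add (scale a q) (0a ∷ mul p q)

  coeff : List A → ℕ → A
  coeff []      _       = 0a
  coeff (a ∷ p) zero    = a
  coeff (a ∷ p) (suc j) = coeff p j

  monomial : A → ℕ → List A
  monomial c d = replicate d 0a ++ (c ∷ [])

  prod : List (List A) → List A → List A
  prod ps one = foldr mul one ps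

  _≈ₚ_ : List A → List A → Set
  p ≈ₚ q = (j : ℕ) → coeff p j ≡ coeff q j

module PolyF2 = Poly false _xor_ _∧_

PF2 : {k : ℕ} → (Fin (suc k) → Bool) → List Bool
PF2 b = toList (tabulate b)

XnPlus1 : ℕ → List Bool
XnPlus1 n = PolyF2.add (true ∷ []) (PolyF2.monomial true n)

_∣F2_ : List Bool → List Bool → Set
p ∣F2 q = Σ (List Bool) (λ r → PolyF2._≈ₚ_ (PolyF2.mul p r) q)

Mat : ℕ → Set
Mat k = Fin k → Fin k → Bool

sumF2 : {k : ℕ} → (Fin k → Bool) → Bool
sumF2 {k} f = foldr _xor_ false (toList (tabulate f))

_·M_ : {k : ℕ} → Mat k → Mat k → Mat k
(M ·M N) i j = sumF2 (λ l → M i l ∧ N l j)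

idM : {k : ℕ} → Mat k
idM i j with i ≟ j
... | yes _ = true
... | no  _ = false

powM : {k : ℕ} → Mat k → ℕ → Mat k
powM M zero    = idM
powM M (suc m) = M ·M powM M m

-- Companion matrix (0-indexed): entry (r , c) is b_r if c = k-1,
-- 1 if r = c+1, and 0 otherwise.  (A_{i+1,i} = 1, A_{i+1,k} = b_i.)
companion : {k : ℕ} → (Fin (suc k) → Bool) → Mat k
companion {zero}  b ()
companion {suc k} b r c with toℕ c Data.Nat.≟ k
... | yes _ = b (inject₁ r)
... | no  _ with toℕ r Data.Nat.≟ suc (toℕ c)
...   | yes _ = true
...   | no  _ = false

_≡M_ : {k : ℕ} → Mat k → Mat k → Set
M ≡M N = ∀ i j → M i j ≡ N i j

allSubsets : (k : ℕ) → List (Vec Bool k)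
allSubsets zero    = [] ∷ []
allSubsets (suc k) = concatMap (λ s → (false ∷ s) ∷ (true ∷ s) ∷ []) (allSubsets k)

module InField {n : ℕ} (F : FiniteField n) where
  open FiniteField F

  module PolyF = Poly 0# _+_ _*_

  embed : Bool → Carrier
  embed true  = 1#
  embed false = 0#

  lin : {k : ℕ} → Vec Carrier k → Vec Bool k → Carrier
  lin []       []        = 0#
  lin (v ∷ vs) (s ∷ ss)  = (if s then v else 0#) + lin vs ss

  LinIndep : {k : ℕ} → Vec Carrier k → Set
  LinIndep {k} v = (S : Vec Bool k) → lin v S ≡ 0# → S ≡ Data.Vec.replicate k false

  sumList : List Carrier → Carrier
  sumList = foldr _+_ 0#

  Lpoly : {k : ℕ} → (Fin (suc k) → Bool) → List Carrier
  Lpoly {k} b = foldr PolyF.add []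
    (toList (tabulate (λ i → PolyF.monomial (embed (b i)) (2 ^ toℕ i))))

  -- L(X) = ∏_{u ∈ E} (X + u) for a k-dimensional F_2-subspace E of F
  -- (E given as the span of a basis v_1,…,v_k).
  SplitsSimple : {k : ℕ} → (Fin (suc k) → Bool) → Set
  SplitsSimple {k} b =
    Σ (Vec Carrier k) λ v → LinIndep v ×
      PolyF._≈ₚ_ (Lpoly b)
        (PolyF.prod (map (λ S → lin v S ∷ 1# ∷ []) (allSubsets k)) (1# ∷ []))

  pow : Carrier → ℕ → Carrier
  pow x zero    = 1#
  pow x (suc m) = x * pow x m

  Finv : Carrier → Carrier
  Finv x = pow x (2 ^ n ∸ 2)

  affineSum : {k : ℕ} → (Carrier → Carrier) → Carrier → Vec Carrier k → Carrier
  affineSum {k} G a v = sumList (map (λ S → G (a + lin v S)) (allSubsets k))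

  SumFree : ℕ → (Carrier → Carrier) → Set
  SumFree k G = (a : Carrier) (v : Vec Carrier k) → LinIndep v → affineSum G a v ≢ 0#

{-# OPTIONS --safe #-}
module Submission where

-- Write P = Σ bᵢ Xⁱ and L_P = Σ bᵢ X^(2^i).  The companion matrix A acts on
-- F₂[X]/(P) as multiplication by X, with e₀ ↔ 1 a cyclic vector, so A^n = I iff
-- P divides X^n + 1.  Over F_(2^n) one has L_(PQ) = L_P ∘ L_Q, and L_(X^n+1) =
-- X^(2^n) + X vanishes identically.  So if P·R = X^n + 1, the image of L_R lies
-- in ker L_P, and a k-dimensional kernel is built one vector at a time: a
-- nonzero polynomial of degree < 2^n has a non-root.  L_P and ∏_{u∈E}(X + u) are
-- then monic of degree 2^k and agree on the 2^k points of E, hence are equal.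
-- Conversely, if L_P splits over E, the remainder R of X^n + 1 modulo P has
-- degree < k and L_R vanishes on E, so R = 0.  For the corollary, 0 ∈ E and the
-- coefficient of X² in ∏_{u∈E}(X + u), which is a₁ = 0, equals
-- ∏_{u≠0} u · Σ_{u≠0} u⁻¹; so F_inv sums to 0 over E.

open import Defs
open import Level using (0ℓ)
open import Function using (_∘_; id)
open import Function.Bundles using (_⇔_; mk⇔; Inverse)
open import Function.Properties.Equivalence using () renaming (sym to ⇔-sym; trans to ⇔-trans)
open import Data.Empty using (⊥-elim)
open import Data.Product using (Σ; _×_; _,_; proj₁)
open import Data.Sum using (_⊎_; inj₁; inj₂; [_,_]′)
open import Data.Nat as ℕ using (ℕ; zero; suc; _≤_; _<_; z≤n; s≤s; _⊔_; _^_)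
import Data.Nat.Properties as ℕP
open import Data.Bool using (Bool; true; false; _xor_; _∧_; if_then_else_)
open import Data.Bool.Properties
  using ( xor-∧-commutativeRing; xor-same; xor-assoc; xor-comm; xor-identityʳ
        ; ∧-identityʳ; ∧-zeroʳ; ∧-assoc; ∧-comm; ∧-distribˡ-xor; ∧-distribʳ-xor )
open import Data.Fin as Fin using (Fin; toℕ; fromℕ; inject₁)
import Data.Fin.Properties as FinP
open import Data.Fin.Permutation using (Permutation; permutation; _⟨$⟩ʳ_)
open import Data.Vec as Vec using (Vec; []; _∷_; tabulate; toList)
import Data.Vec.Properties as VP
open import Data.List as List using (List; []; _∷_; _++_; length; map; replicate; foldr; take; concatMap)
import Data.List.Properties as LP
open import Data.List.Membership.Propositional using (_∈_)
open import Data.List.Membership.Propositional.Properties using (∈-map⁺)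
open import Data.List.Relation.Unary.All as All using (All; []; _∷_)
import Data.List.Relation.Unary.All.Properties as AllP
open import Data.List.Relation.Unary.Any as Any using (Any; here; there)
import Data.List.Relation.Unary.Any.Properties as AnyP
open import Data.List.Relation.Unary.AllPairs using ([]; _∷_)
open import Data.List.Relation.Unary.Unique.Propositional using (Unique)
import Data.List.Relation.Unary.Unique.Propositional.Properties as UniqueP
open import Relation.Nullary using (¬_; yes; no)
import Relation.Nullary.Decidable as Dec
open import Relation.Binary.Definitions using (DecidableEquality)
open import Relation.Binary.Bundles using (Setoid)
import Relation.Binary.Reasoning.Setoid as SetoidReasoning
open import Relation.Binary.PropositionalEquality
open import Algebra.Structures using (IsCommutativeRing)
open import Algebra.Bundles using (CommutativeRing)

module Polynomials {C : Set} {plus times : C → C → C} {neg : C → C} {zero′ one : C}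
                   (isCR : IsCommutativeRing _≡_ plus times neg zero′ one) where

  ring : CommutativeRing 0ℓ 0ℓ
  ring = record { isCommutativeRing = isCR }

  open CommutativeRing ring public
    using ( _+_; _*_; -_; 0#; 1#; +-identityˡ; +-identityʳ; *-identityˡ; *-identityʳ; zeroˡ; zeroʳ
          ; distribˡ; distribʳ; +-comm; *-comm; +-assoc; *-assoc; -‿inverseˡ; -‿inverseʳ )
  open CommutativeRing ring using (commutativeSemiring; +-commutativeSemigroup)
  open import Algebra.Properties.CommutativeSemigroup +-commutativeSemigroup public
    using () renaming (interchange to +-interchange)
  open import Algebra.Properties.CommutativeSemigroup (CommutativeRing.*-commutativeSemigroup ring) public
    using (x∙yz≈y∙xz)
  open import Algebra.Properties.Ring (CommutativeRing.ring ring) public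
    using (-‿involutive; -1*x≈-x) renaming (x∙y⁻¹≈ε⇒x≈y to x-y≡0⇒x≡y)
  open import Algebra.Solver.Ring.NaturalCoefficients.Default commutativeSemiring public
  open Poly 0# _+_ _*_ public

  -- A record around Defs' coefficientwise equality, so that the compared
  -- polynomials can be inferred from it.
  infix 4 _≈_
  record _≈_ (p q : List C) : Set where
    constructor mk≈
    field coeff-≡ : p ≈ₚ q
  open _≈_ public

  ≈-setoid : Setoid 0ℓ 0ℓ
  ≈-setoid = record
    { Carrier       = List C
    ; _≈_           = _≈_
    ; isEquivalence = record
      { refl  = mk≈ λ _ → refl
      ; sym   = λ p≈q → mk≈ λ j → sym (coeff-≡ p≈q j)
      ; trans = λ p≈q q≈r → mk≈ λ j → trans (coeff-≡ p≈q j) (coeff-≡ q≈r j)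
      }
    }

  open Setoid ≈-setoid public using () renaming (refl to ≈-refl; sym to ≈-sym; trans to ≈-trans)
  module ≈-Reasoning = SetoidReasoning ≈-setoid

  ≡⇒≈ : ∀ {p q} → p ≡ q → p ≈ q
  ≡⇒≈ refl = ≈-refl

  ∷-cong : ∀ {c d p q} → c ≡ d → p ≈ q → c ∷ p ≈ d ∷ q
  ∷-cong c≡d p≈q = mk≈ λ { zero → c≡d ; (suc j) → coeff-≡ p≈q j }

  ∷-≈[] : ∀ {c p} → c ≡ 0# → p ≈ [] → c ∷ p ≈ []
  ∷-≈[] c≡0 p≈0 = mk≈ λ { zero → c≡0 ; (suc j) → coeff-≡ p≈0 j }

  ∷-≈-tail : ∀ {c d p q} → c ∷ p ≈ d ∷ q → p ≈ q
  ∷-≈-tail c∷p≈d∷q = mk≈ (coeff-≡ c∷p≈d∷q ∘ suc)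

  ∷-≈[]-tail : ∀ {c p} → c ∷ p ≈ [] → p ≈ []
  ∷-≈[]-tail c∷p≈0 = mk≈ (coeff-≡ c∷p≈0 ∘ suc)

  coeff-add : ∀ p q j → coeff (add p q) j ≡ coeff p j + coeff q j
  coeff-add []      q       j       = sym (+-identityˡ _)
  coeff-add (a ∷ p) []      j       = sym (+-identityʳ _)
  coeff-add (a ∷ p) (b ∷ q) zero    = refl
  coeff-add (a ∷ p) (b ∷ q) (suc j) = coeff-add p q j

  coeff-scale : ∀ a p j → coeff (scale a p) j ≡ a * coeff p j
  coeff-scale a []      j       = sym (zeroʳ a)
  coeff-scale a (x ∷ p) zero    = refl
  coeff-scale a (x ∷ p) (suc j) = coeff-scale a p j

  coeff-beyond : ∀ p {j} → length p ≤ j → coeff p j ≡ 0#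
  coeff-beyond []      _         = refl
  coeff-beyond (c ∷ p) (s≤s p≤j) = coeff-beyond p p≤j

  coeff-monomial-≡ : ∀ c d → coeff (monomial c d) d ≡ c
  coeff-monomial-≡ c zero    = refl
  coeff-monomial-≡ c (suc d) = coeff-monomial-≡ c d

  coeff-monomial-≢ : ∀ c d {j} → j ≢ d → coeff (monomial c d) j ≡ 0#
  coeff-monomial-≢ c zero    {zero}  j≢d = ⊥-elim (j≢d refl)
  coeff-monomial-≢ c zero    {suc j} j≢d = refl
  coeff-monomial-≢ c (suc d) {zero}  j≢d = refl
  coeff-monomial-≢ c (suc d) {suc j} j≢d = coeff-monomial-≢ c d (j≢d ∘ cong suc)

  coeff-monomial-0 : ∀ d j → coeff (monomial 0# d) j ≡ 0#
  coeff-monomial-0 d j with j ℕ.≟ d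
  ... | yes refl = coeff-monomial-≡ 0# d
  ... | no  j≢d  = coeff-monomial-≢ 0# d j≢d

  length-monomial : ∀ c d → length (monomial c d) ≡ suc d
  length-monomial c d = begin
    length (replicate d 0# ++ c ∷ [])  ≡⟨ LP.length-++ (replicate d 0#) ⟩
    length (replicate d 0#) ℕ.+ 1     ≡⟨ cong (ℕ._+ 1) (LP.length-replicate d) ⟩
    d ℕ.+ 1                           ≡⟨ ℕP.+-comm d 1 ⟩
    suc d                             ∎
    where open ≡-Reasoning

  add-cong : ∀ {p p′ q q′} → p ≈ p′ → q ≈ q′ → add p q ≈ add p′ q′
  add-cong {p} {p′} {q} {q′} p≈p′ q≈q′ = mk≈ λ j → begin
    coeff (add p q) j          ≡⟨ coeff-add p q j ⟩
    coeff p j + coeff q j      ≡⟨ cong₂ _+_ (coeff-≡ p≈p′ j) (coeff-≡ q≈q′ j) ⟩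
    coeff p′ j + coeff q′ j    ≡⟨ coeff-add p′ q′ j ⟨
    coeff (add p′ q′) j        ∎
    where open ≡-Reasoning

  add-congʳ : ∀ p {q q′} → q ≈ q′ → add p q ≈ add p q′
  add-congʳ p = add-cong (≈-refl {p})

  add-identityʳ : ∀ p → add p [] ≡ p
  add-identityʳ []      = refl
  add-identityʳ (a ∷ p) = refl

  add-interchange : ∀ p q r s → add (add p q) (add r s) ≈ add (add p r) (add q s)
  add-interchange p q r s = mk≈ λ j → begin
    coeff (add (add p q) (add r s)) j                        ≡⟨ coeff-add (add p q) (add r s) j ⟩
    coeff (add p q) j + coeff (add r s) j                    ≡⟨ cong₂ _+_ (coeff-add p q j) (coeff-add r s j) ⟩
    (coeff p j + coeff q j) + (coeff r j + coeff s j)        ≡⟨ +-interchange _ _ _ _ ⟩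
    (coeff p j + coeff r j) + (coeff q j + coeff s j)        ≡⟨ cong₂ _+_ (coeff-add p r j) (coeff-add q s j) ⟨
    coeff (add p r) j + coeff (add q s) j                    ≡⟨ coeff-add (add p r) (add q s) j ⟨
    coeff (add (add p r) (add q s)) j                        ∎
    where open ≡-Reasoning

  scale-cong : ∀ a {p q} → p ≈ q → scale a p ≈ scale a q
  scale-cong a {p} {q} p≈q = mk≈ λ j →
    trans (coeff-scale a p j) (trans (cong (a *_) (coeff-≡ p≈q j)) (sym (coeff-scale a q j)))

  scale-add : ∀ a p q → scale a (add p q) ≈ add (scale a p) (scale a q)
  scale-add a p q = mk≈ λ j → begin
    coeff (scale a (add p q)) j                 ≡⟨ coeff-scale a (add p q) j ⟩
    a * coeff (add p q) j                       ≡⟨ cong (a *_) (coeff-add p q j) ⟩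
    a * (coeff p j + coeff q j)                 ≡⟨ distribˡ a _ _ ⟩
    a * coeff p j + a * coeff q j               ≡⟨ cong₂ _+_ (coeff-scale a p j) (coeff-scale a q j) ⟨
    coeff (scale a p) j + coeff (scale a q) j   ≡⟨ coeff-add (scale a p) (scale a q) j ⟨
    coeff (add (scale a p) (scale a q)) j       ∎
    where open ≡-Reasoning

  0∷-add : ∀ p q → 0# ∷ add p q ≈ add (0# ∷ p) (0# ∷ q)
  0∷-add p q = ∷-cong (sym (+-identityˡ 0#)) ≈-refl

  mul-congʳ : ∀ p {q q′} → q ≈ q′ → mul p q ≈ mul p q′
  mul-congʳ []      q≈q′ = ≈-refl
  mul-congʳ (a ∷ p) q≈q′ = add-cong (scale-cong a q≈q′) (∷-cong refl (mul-congʳ p q≈q′))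

  mul-zeroʳ : ∀ p → mul p [] ≈ []
  mul-zeroʳ []      = ≈-refl
  mul-zeroʳ (a ∷ p) = ∷-≈[] refl (mul-zeroʳ p)

  mul-0∷ : ∀ p q → mul p (0# ∷ q) ≈ 0# ∷ mul p q
  mul-0∷ []      q = mk≈ λ { zero → refl ; (suc j) → refl }
  mul-0∷ (a ∷ p) q = ∷-cong (trans (+-identityʳ _) (zeroʳ a)) (add-congʳ (scale a q) (mul-0∷ p q))

  mul-distribˡ : ∀ p q r → mul p (add q r) ≈ add (mul p q) (mul p r)
  mul-distribˡ []      q r = ≈-refl
  mul-distribˡ (a ∷ p) q r = begin
    add (scale a (add q r)) (0# ∷ mul p (add q r))
      ≈⟨ add-cong (scale-add a q r) (∷-cong refl (mul-distribˡ p q r)) ⟩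
    add (add (scale a q) (scale a r)) (0# ∷ add (mul p q) (mul p r))
      ≈⟨ add-congʳ (add (scale a q) (scale a r)) (0∷-add (mul p q) (mul p r)) ⟩
    add (add (scale a q) (scale a r)) (add (0# ∷ mul p q) (0# ∷ mul p r))
      ≈⟨ add-interchange (scale a q) (scale a r) _ _ ⟩
    add (mul (a ∷ p) q) (mul (a ∷ p) r) ∎
    where open ≈-Reasoning

  add-assoc : ∀ p q r → add (add p q) r ≈ add p (add q r)
  add-assoc p q r = mk≈ λ j → begin
    coeff (add (add p q) r) j                ≡⟨ coeff-add (add p q) r j ⟩
    coeff (add p q) j + coeff r j            ≡⟨ cong (_+ coeff r j) (coeff-add p q j) ⟩
    coeff p j + coeff q j + coeff r j        ≡⟨ +-assoc _ _ _ ⟩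
    coeff p j + (coeff q j + coeff r j)      ≡⟨ cong (coeff p j +_) (coeff-add q r j) ⟨
    coeff p j + coeff (add q r) j            ≡⟨ coeff-add p (add q r) j ⟨
    coeff (add p (add q r)) j                ∎
    where open ≡-Reasoning

  mul-singletonʳ : ∀ p c → mul p (c ∷ []) ≈ scale c p
  mul-singletonʳ []      c = ≈-refl
  mul-singletonʳ (a ∷ p) c = ∷-cong (trans (+-identityʳ _) (*-comm a c)) (mul-singletonʳ p c)

  ++-0#-≈ : ∀ c → c ++ 0# ∷ [] ≈ c
  ++-0#-≈ []      = mk≈ λ { zero → refl ; (suc j) → refl }
  ++-0#-≈ (x ∷ c) = ∷-cong refl (++-0#-≈ c)

  take-≈ : ∀ m p → (∀ j → m ≤ j → coeff p j ≡ 0#) → take m p ≈ p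
  take-≈ zero    p       high≡0 = mk≈ λ j → sym (high≡0 j z≤n)
  take-≈ (suc m) []      high≡0 = ≈-refl
  take-≈ (suc m) (c ∷ p) high≡0 = ∷-cong refl (take-≈ m p λ j m≤j → high≡0 (suc j) (s≤s m≤j))

  eval : List C → C → C
  eval []      x = 0#
  eval (c ∷ p) x = c + x * eval p x

  eval-≈[] : ∀ p x → p ≈ [] → eval p x ≡ 0#
  eval-≈[] []      x p≈0 = refl
  eval-≈[] (c ∷ p) x p≈0 = begin
    c + x * eval p x    ≡⟨ cong₂ (λ u v → u + x * v) (coeff-≡ p≈0 0) (eval-≈[] p x (∷-≈[]-tail p≈0)) ⟩
    0# + x * 0#         ≡⟨ +-identityˡ _ ⟩
    x * 0#              ≡⟨ zeroʳ x ⟩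
    0#                  ∎
    where open ≡-Reasoning

  eval-cong : ∀ {p q} x → p ≈ q → eval p x ≡ eval q x
  eval-cong {[]}    {q}     x p≈q = sym (eval-≈[] q x (≈-sym p≈q))
  eval-cong {c ∷ p} {[]}    x p≈q = eval-≈[] (c ∷ p) x p≈q
  eval-cong {c ∷ p} {d ∷ q} x p≈q =
    cong₂ (λ u v → u + x * v) (coeff-≡ p≈q 0) (eval-cong x (∷-≈-tail p≈q))

  eval-add : ∀ p q x → eval (add p q) x ≡ eval p x + eval q x
  eval-add []      q       x = sym (+-identityˡ _)
  eval-add (a ∷ p) []      x = sym (+-identityʳ _)
  eval-add (a ∷ p) (b ∷ q) x =
    trans (cong (λ z → a + b + x * z) (eval-add p q x)) (regroup a b x (eval p x) (eval q x))
    where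
      regroup : ∀ a b x u v → a + b + x * (u + v) ≡ (a + x * u) + (b + x * v)
      regroup = solve 5 (λ a b x u v → a :+ b :+ x :* (u :+ v) := (a :+ x :* u) :+ (b :+ x :* v)) refl

  eval-scale : ∀ a p x → eval (scale a p) x ≡ a * eval p x
  eval-scale a []      x = sym (zeroʳ a)
  eval-scale a (c ∷ p) x = trans (cong (λ z → a * c + x * z) (eval-scale a p x)) (regroup a c x (eval p x))
    where
      regroup : ∀ a c x u → a * c + x * (a * u) ≡ a * (c + x * u)
      regroup = solve 4 (λ a c x u → a :* c :+ x :* (a :* u) := a :* (c :+ x :* u)) refl

  eval-mul : ∀ p q x → eval (mul p q) x ≡ eval p x * eval q x
  eval-mul []      q x = sym (zeroˡ _)
  eval-mul (a ∷ p) q x = begin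
    eval (add (scale a q) (0# ∷ mul p q)) x      ≡⟨ eval-add (scale a q) (0# ∷ mul p q) x ⟩
    eval (scale a q) x + (0# + x * eval (mul p q) x)
      ≡⟨ cong₂ _+_ (eval-scale a q x) (trans (+-identityˡ _) (cong (x *_) (eval-mul p q x))) ⟩
    a * eval q x + x * (eval p x * eval q x)    ≡⟨ regroup a x (eval p x) (eval q x) ⟩
    (a + x * eval p x) * eval q x               ∎
    where
      open ≡-Reasoning
      regroup : ∀ a x u v → a * v + x * (u * v) ≡ (a + x * u) * v
      regroup = solve 4 (λ a x u v → a :* v :+ x :* (u :* v) := (a :+ x :* u) :* v) refl

  product : List C → C
  product = foldr _*_ 1#

  eval-prod : ∀ ps x → eval (prod ps (1# ∷ [])) x ≡ product (map (λ p → eval p x) ps)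
  eval-prod []       x = trans (cong (1# +_) (zeroʳ x)) (+-identityʳ _)
  eval-prod (p ∷ ps) x = trans (eval-mul p (prod ps (1# ∷ [])) x) (cong (eval p x *_) (eval-prod ps x))

  product-zero : ∀ {A : Set} (f : A → C) {xs} → Any (λ x → f x ≡ 0#) xs → product (map f xs) ≡ 0#
  product-zero f {x ∷ xs} (here fx≡0)  = trans (cong (_* product (map f xs)) fx≡0) (zeroˡ _)
  product-zero f {x ∷ xs} (there any0) = trans (cong (f x *_) (product-zero f any0)) (zeroʳ _)

  Monic : ℕ → List C → Set
  Monic d p = Σ (List C) λ c → length c ≡ d × p ≡ c ++ 1# ∷ []

  monic-length : ∀ {d p} → Monic d p → length p ≡ suc d
  monic-length (c , refl , refl) = trans (LP.length-++ c) (ℕP.+-comm (length c) 1)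

  monic-leading : ∀ {d p} → Monic d p → coeff p d ≡ 1#
  monic-leading (c , refl , refl) = leading c
    where
      leading : ∀ c → coeff (c ++ 1# ∷ []) (length c) ≡ 1#
      leading []      = refl
      leading (x ∷ c) = leading c

  monomial-monic : ∀ d → Monic d (monomial 1# d)
  monomial-monic d = replicate d 0# , LP.length-replicate d , refl

  length-add : ∀ p q → length (add p q) ≡ length p ⊔ length q
  length-add []      q       = refl
  length-add (a ∷ p) []      = refl
  length-add (a ∷ p) (b ∷ q) = cong suc (length-add p q)

  add-++ʳ : ∀ q c x → length q ≤ length c → add q (c ++ x ∷ []) ≡ add q c ++ x ∷ []
  add-++ʳ []      c       x _         = refl
  add-++ʳ (a ∷ q) (b ∷ c) x (s≤s q≤c) = cong ((a + b) ∷_) (add-++ʳ q c x q≤c)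

  add-++-++ : ∀ c d x y → length c ≡ length d → add (c ++ x ∷ []) (d ++ y ∷ []) ≡ add c d ++ (x + y) ∷ []
  add-++-++ []      []      x y _   = refl
  add-++-++ (a ∷ c) (b ∷ d) x y c≡d = cong ((a + b) ∷_) (add-++-++ c d x y (ℕP.suc-injective c≡d))

  scale-identity : ∀ p → scale 1# p ≡ p
  scale-identity []      = refl
  scale-identity (a ∷ p) = cong₂ _∷_ (*-identityˡ a) (scale-identity p)

  one-mul-++ : ∀ c → mul (1# ∷ []) (c ++ 1# ∷ []) ≡ c ++ 1# ∷ []
  one-mul-++ []      = cong (_∷ []) (trans (+-identityʳ _) (*-identityˡ 1#))
  one-mul-++ (a ∷ c) = cong₂ _∷_ (trans (+-identityʳ _) (*-identityˡ a)) (trans (add-identityʳ _) (scale-identity _))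

  mul-identityˡ : ∀ p → mul (1# ∷ []) p ≈ p
  mul-identityˡ p = begin
    add (scale 1# p) (0# ∷ [])   ≈⟨ add-congʳ (scale 1# p) (∷-≈[] refl ≈-refl) ⟩
    add (scale 1# p) []          ≡⟨ add-identityʳ (scale 1# p) ⟩
    scale 1# p                   ≡⟨ scale-identity p ⟩
    p                            ∎
    where open ≈-Reasoning

  coeff-X+u-mul-0 : ∀ u p → coeff (mul (u ∷ 1# ∷ []) p) 0 ≡ u * coeff p 0
  coeff-X+u-mul-0 u p = trans (coeff-add (scale u p) (0# ∷ mul (1# ∷ []) p) 0) (trans (+-identityʳ _) (coeff-scale u p 0))

  coeff-X+u-mul-suc : ∀ u p j → coeff (mul (u ∷ 1# ∷ []) p) (suc j) ≡ u * coeff p (suc j) + coeff p j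
  coeff-X+u-mul-suc u p j = trans (coeff-add (scale u p) (0# ∷ mul (1# ∷ []) p) (suc j))
                                  (cong₂ _+_ (coeff-scale u p (suc j)) (coeff-≡ (mul-identityˡ p) j))

  monic-add-low : ∀ {d p} q → length q ≤ d → Monic d p → Monic d (add q p)
  monic-add-low q q≤d (c , refl , refl) =
    add q c , trans (length-add q c) (ℕP.m≤n⇒m⊔n≡n q≤d) , add-++ʳ q c 1# q≤d

  monic-mul : ∀ {d e p q} → Monic d p → Monic e q → Monic (d ℕ.+ e) (mul p q)
  monic-mul {q = q} (c , refl , refl) q-monic@(c′ , refl , refl) = go c
    where
      go : ∀ c → Monic (length c ℕ.+ length c′) (mul (c ++ 1# ∷ []) q)
      go []      = c′ , refl , one-mul-++ c′
      go (a ∷ c) with go c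
      ... | m , m-length , m-eq = subst (Monic (suc (length c ℕ.+ length c′))) (cong (λ r → add (scale a q) (0# ∷ r)) (sym m-eq))
        (monic-add-low (scale a q) short (0# ∷ m , cong suc m-length , refl))
        where
          short : length (scale a q) ≤ suc (length c ℕ.+ length c′)
          short = subst (_≤ suc (length c ℕ.+ length c′)) (sym (trans (LP.length-map (a *_) q) (monic-length q-monic)))
                        (s≤s (ℕP.m≤n+m (length c′) (length c)))

  monic-prod : ∀ d ps → All (Monic d) ps → Monic (length ps ℕ.* d) (prod ps (1# ∷ []))
  monic-prod d []       []         = [] , refl , refl
  monic-prod d (p ∷ ps) (mp ∷ mps) = monic-mul mp (monic-prod d ps mps)

  quotLinear : C → List C → List C
  quotLinear a []          = []
  quotLinear a (c ∷ [])    = []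
  quotLinear a (c ∷ d ∷ p) = eval (d ∷ p) a ∷ quotLinear a (d ∷ p)

  eval-quotLinear : ∀ a p x → eval p x ≡ (x + - a) * eval (quotLinear a p) x + eval p a
  eval-quotLinear a [] x = sym (trans (+-identityʳ _) (zeroʳ _))
  eval-quotLinear a (c ∷ []) x = begin
    c + x * 0#                      ≡⟨ cong (c +_) (zeroʳ x) ⟩
    c + 0#                          ≡⟨ +-identityʳ c ⟩
    c                               ≡⟨ +-identityˡ c ⟨
    0# + c                          ≡⟨ cong₂ _+_ (zeroʳ _) (trans (cong (c +_) (zeroʳ a)) (+-identityʳ c)) ⟨
    (x + - a) * 0# + (c + a * 0#)   ∎
    where open ≡-Reasoning
  eval-quotLinear a (c ∷ d ∷ p) x = begin
    c + x * eval (d ∷ p) x                    ≡⟨ cong (λ z → c + x * z) (eval-quotLinear a (d ∷ p) x) ⟩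
    c + x * ((x + - a) * G + r)               ≡⟨ +-identityʳ _ ⟨
    c + x * ((x + - a) * G + r) + 0#          ≡⟨ cong (c + x * ((x + - a) * G + r) +_) (trans (cong (_* r) (-‿inverseˡ a)) (zeroˡ r)) ⟨
    c + x * ((x + - a) * G + r) + (- a + a) * r ≡⟨ regroup c x a (- a) G r ⟩
    (x + - a) * (r + x * G) + (c + a * r)     ∎
    where
      open ≡-Reasoning
      G r : C
      G = eval (quotLinear a (d ∷ p)) x
      r = eval (d ∷ p) a
      regroup : ∀ c x a na G r → c + x * ((x + na) * G + r) + (na + a) * r ≡ (x + na) * (r + x * G) + (c + a * r)
      regroup = solve 6 (λ c x a na G r → c :+ x :* ((x :+ na) :* G :+ r) :+ (na :+ a) :* r
                                        := (x :+ na) :* (r :+ x :* G) :+ (c :+ a :* r)) refl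

  quotLinear-≈[] : ∀ a p → quotLinear a p ≈ [] → eval p a ≡ 0# → p ≈ []
  quotLinear-≈[] a []          _     _      = ≈-refl
  quotLinear-≈[] a (c ∷ [])    _   pa≡0 =
    ∷-≈[] (trans (sym (trans (cong (c +_) (zeroʳ a)) (+-identityʳ c))) pa≡0) ≈-refl
  quotLinear-≈[] a (c ∷ d ∷ p) q≈0 pa≡0 =
    ∷-≈[] (trans (sym (trans (cong (λ z → c + a * z) (coeff-≡ q≈0 0)) (trans (cong (c +_) (zeroʳ a)) (+-identityʳ c)))) pa≡0)
          (quotLinear-≈[] a (d ∷ p) (∷-≈[]-tail q≈0) (coeff-≡ q≈0 0))

  length-quotLinear : ∀ a p {m} → length p ≤ suc m → length (quotLinear a p) ≤ m
  length-quotLinear a []          _         = z≤n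
  length-quotLinear a (c ∷ [])    _         = z≤n
  length-quotLinear a (c ∷ d ∷ p) {suc m} (s≤s p≤m) = s≤s (length-quotLinear a (d ∷ p) p≤m)

  module RootBound (zero-divisor : ∀ x y → x * y ≡ 0# → x ≡ 0# ⊎ y ≡ 0#) where

    quotLinear-roots : ∀ a p {rs} → All (a ≢_) rs → All (λ r → eval p r ≡ 0#) rs → eval p a ≡ 0# →
                       All (λ r → eval (quotLinear a p) r ≡ 0#) rs
    quotLinear-roots a p {[]}     []           []           _    = []
    quotLinear-roots a p {r ∷ rs} (a≢r ∷ a≢rs) (pr≡0 ∷ prs) pa≡0 =
      [ (λ r-a≡0 → ⊥-elim (a≢r (sym (x-y≡0⇒x≡y r a r-a≡0)))) , id ]′ (zero-divisor _ _ factored)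
      ∷ quotLinear-roots a p a≢rs prs pa≡0
      where
        factored : (r + - a) * eval (quotLinear a p) r ≡ 0#
        factored = begin
          (r + - a) * eval (quotLinear a p) r          ≡⟨ +-identityʳ _ ⟨
          (r + - a) * eval (quotLinear a p) r + 0#     ≡⟨ cong ((r + - a) * eval (quotLinear a p) r +_) pa≡0 ⟨
          (r + - a) * eval (quotLinear a p) r + eval p a ≡⟨ eval-quotLinear a p r ⟨
          eval p r                                     ≡⟨ pr≡0 ⟩
          0#                                           ∎
          where open ≡-Reasoning

    many-roots⇒≈[] : ∀ rs p → Unique rs → All (λ r → eval p r ≡ 0#) rs → length p ≤ length rs → p ≈ []
    many-roots⇒≈[] []       []  _              _            _       = ≈-refl
    many-roots⇒≈[] (a ∷ rs) p   (a≢rs ∷ rs≢)  (pa≡0 ∷ prs) p≤1+rs =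
      quotLinear-≈[] a p
        (many-roots⇒≈[] rs (quotLinear a p) rs≢ (quotLinear-roots a p a≢rs prs pa≡0) (length-quotLinear a p p≤1+rs))
        pa≡0

module F₂ = Polynomials (CommutativeRing.isCommutativeRing xor-∧-commutativeRing)

module BinaryPolynomials where

  open F₂ using (_≈_; mk≈; coeff-≡; ≈-refl; ≈-sym; ≈-trans; Monic; coeff-add; module ≈-Reasoning)
  open PolyF2 using (add; mul; scale; coeff; monomial)

  true≢false : true ≢ false
  true≢false ()

  xor≡false⇒≡ : ∀ x y → x xor y ≡ false → x ≡ y
  xor≡false⇒≡ false false _ = refl
  xor≡false⇒≡ true  true  _ = refl

  ≈[]⊎monic : ∀ p → p ≈ [] ⊎ Σ (List Bool) λ c → p ≈ c ++ true ∷ []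
  ≈[]⊎monic []      = inj₁ ≈-refl
  ≈[]⊎monic (x ∷ p) with ≈[]⊎monic p
  ... | inj₂ (c , p≈c) = inj₂ (x ∷ c , F₂.∷-cong refl p≈c)
  ≈[]⊎monic (true  ∷ p) | inj₁ p≈0 = inj₂ ([] , F₂.∷-cong refl p≈0)
  ≈[]⊎monic (false ∷ p) | inj₁ p≈0 = inj₁ (F₂.∷-≈[] refl p≈0)

  module Division {k P} (P-monic : Monic k P) where

    -- Over F₂ the leading coefficient of T is also the multiple of P to subtract.
    reduce : ∀ T → length T ≤ suc k → Σ Bool λ t → Σ (List Bool) λ R → length R ≤ k × T ≈ add (scale t P) R
    reduce T T≤1+k = t , take k U , ℕP.≤-trans (ℕP.≤-reflexive (LP.length-take k U)) (ℕP.m⊓n≤m k _) , T≈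
      where
        t : Bool
        t = coeff T k
        U : List Bool
        U = add (scale t P) T
        U-high : ∀ j → k ≤ j → coeff U j ≡ false
        U-high j k≤j with j ℕ.≟ k
        ... | yes refl = begin
          coeff U k                           ≡⟨ coeff-add (scale t P) T k ⟩
          coeff (scale t P) k xor t           ≡⟨ cong (_xor t) (F₂.coeff-scale t P k) ⟩
          (t ∧ coeff P k) xor t               ≡⟨ cong (λ c → (t ∧ c) xor t) (F₂.monic-leading P-monic) ⟩
          (t ∧ true) xor t                    ≡⟨ cong (_xor t) (∧-identityʳ t) ⟩
          t xor t                             ≡⟨ xor-same t ⟩
          false                               ∎
          where open ≡-Reasoning
        ... | no j≢k = F₂.coeff-beyond U (ℕP.≤-trans U-length (ℕP.≤∧≢⇒< k≤j (j≢k ∘ sym)))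
          where
            U-length : length U ≤ suc k
            U-length = subst (_≤ suc k) (sym (F₂.length-add (scale t P) T))
              (ℕP.⊔-lub (ℕP.≤-reflexive (trans (LP.length-map (t ∧_) P) (F₂.monic-length P-monic))) T≤1+k)
        cancel : ∀ j → coeff T j ≡ coeff (add (scale t P) U) j
        cancel j = sym (begin
          coeff (add (scale t P) U) j       ≡⟨ coeff-add (scale t P) U j ⟩
          x xor coeff U j                   ≡⟨ cong (x xor_) (coeff-add (scale t P) T j) ⟩
          x xor (x xor coeff T j)           ≡⟨ xor-assoc x x _ ⟨
          (x xor x) xor coeff T j           ≡⟨ cong (_xor coeff T j) (xor-same x) ⟩
          coeff T j                         ∎)
          where
            open ≡-Reasoning
            x : Bool
            x = coeff (scale t P) j
        T≈ : T ≈ add (scale t P) (take k U)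
        T≈ = ≈-trans (mk≈ cancel) (F₂.add-congʳ (scale t P) (≈-sym (F₂.take-≈ k U U-high)))

    divMod : ∀ f → Σ (List Bool) λ Q → Σ (List Bool) λ R → length R ≤ k × f ≈ add (mul P Q) R
    divMod []      = [] , [] , z≤n , ≈-sym (≈-trans (F₂.≡⇒≈ (F₂.add-identityʳ (mul P []))) (F₂.mul-zeroʳ P))
    divMod (c ∷ f) with divMod f
    ... | Q′ , R′ , R′≤k , f≈ with reduce (c ∷ R′) (s≤s R′≤k)
    ... | t , R , R≤k , c∷R′≈ = t ∷ Q′ , R , R≤k , (begin
      c ∷ f                                          ≈⟨ F₂.∷-cong refl f≈ ⟩
      add (false ∷ mul P Q′) (c ∷ R′)                ≈⟨ F₂.add-cong (≈-sym (F₂.mul-0∷ P Q′)) c∷R′≈ ⟩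
      add (mul P (false ∷ Q′)) (add (scale t P) R)   ≈⟨ F₂.add-assoc (mul P (false ∷ Q′)) (scale t P) R ⟨
      add (add (mul P (false ∷ Q′)) (scale t P)) R   ≈⟨ F₂.add-cong mul-step (≈-refl {R}) ⟨
      add (mul P (t ∷ Q′)) R                         ∎)
      where
        open ≈-Reasoning
        mul-step : mul P (t ∷ Q′) ≈ add (mul P (false ∷ Q′)) (scale t P)
        mul-step = begin
          mul P (t ∷ Q′)                                 ≈⟨ F₂.mul-congʳ P (F₂.∷-cong refl (F₂.≡⇒≈ (sym (F₂.add-identityʳ Q′)))) ⟩
          mul P (add (false ∷ Q′) (t ∷ []))              ≈⟨ F₂.mul-distribˡ P (false ∷ Q′) (t ∷ []) ⟩
          add (mul P (false ∷ Q′)) (mul P (t ∷ []))      ≈⟨ F₂.add-congʳ (mul P (false ∷ Q′)) (F₂.mul-singletonʳ P t) ⟩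
          add (mul P (false ∷ Q′)) (scale t P)           ∎

    remainder-≈[]⇒∣ : ∀ {f} Q R → f ≈ add (mul P Q) R → R ≈ [] → P ∣F2 f
    remainder-≈[]⇒∣ {f} Q R f≈ R≈0 = Q , coeff-≡ (≈-sym (begin
      f                    ≈⟨ f≈ ⟩
      add (mul P Q) R      ≈⟨ F₂.add-congʳ (mul P Q) R≈0 ⟩
      add (mul P Q) []     ≡⟨ F₂.add-identityʳ (mul P Q) ⟩
      mul P Q              ∎))
      where open ≈-Reasoning

  coeff-XnPlus1 : ∀ n {j} → 1 ≤ j → coeff (XnPlus1 n) j ≡ true → j ≡ n
  coeff-XnPlus1 n {suc j} _ coeff≡true with suc j ℕ.≟ n
  ... | yes j≡n = j≡n
  ... | no  j≢n = ⊥-elim (true≢false (begin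
    true                                                ≡⟨ coeff≡true ⟨
    coeff (XnPlus1 n) (suc j)                           ≡⟨ coeff-add (true ∷ []) (monomial true n) (suc j) ⟩
    coeff (monomial true n) (suc j)                     ≡⟨ F₂.coeff-monomial-≢ true n j≢n ⟩
    false                                               ∎))
    where open ≡-Reasoning

  cofactor-monic : ∀ {k n P r} → 1 ≤ k → 1 ≤ n → Monic k P → mul P r ≈ XnPlus1 n →
                   Σ (List Bool) λ c → r ≈ c ++ true ∷ [] × k ℕ.+ length c ≡ n
  cofactor-monic {k} {suc n} {P} {r} 1≤k _ P-monic Pr≈ with ≈[]⊎monic r
  ... | inj₁ r≈0 = ⊥-elim (true≢false (trans (sym (coeff-≡ Pr≈ 0)) (coeff-≡ (≈-trans (F₂.mul-congʳ P r≈0) (F₂.mul-zeroʳ P)) 0)))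
  ... | inj₂ (c , r≈) = c , r≈ , coeff-XnPlus1 (suc n) (ℕP.≤-trans 1≤k (ℕP.m≤m+n k _)) leading
    where
      leading : coeff (XnPlus1 (suc n)) (k ℕ.+ length c) ≡ true
      leading = trans (sym (coeff-≡ Pr≈ _))
                  (trans (coeff-≡ (F₂.mul-congʳ P r≈) _) (F₂.monic-leading (F₂.monic-mul P-monic (c , refl , refl))))

  ∣XnPlus1⇒deg≤ : ∀ {k n P} → 1 ≤ k → 1 ≤ n → Monic k P → P ∣F2 XnPlus1 n → k ≤ n
  ∣XnPlus1⇒deg≤ {k} 1≤k 1≤n P-monic (r , Pr≈) with cofactor-monic 1≤k 1≤n P-monic (mk≈ Pr≈)
  ... | c , _ , k+e≡n = subst (k ≤_) k+e≡n (ℕP.m≤m+n k (length c))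

  coeff-tabulate : ∀ {m} (f : Fin m → Bool) i → coeff (toList (tabulate f)) (toℕ i) ≡ f i
  coeff-tabulate f Fin.zero    = refl
  coeff-tabulate f (Fin.suc i) = coeff-tabulate (f ∘ Fin.suc) i

  toList-tabulate-last : ∀ {m} (f : Fin (suc m) → Bool) →
                         toList (tabulate f) ≡ toList (tabulate (f ∘ inject₁)) ++ f (fromℕ m) ∷ []
  toList-tabulate-last {zero}  f = refl
  toList-tabulate-last {suc m} f = cong (f Fin.zero ∷_) (toList-tabulate-last (f ∘ Fin.suc))

  PF2-monic : ∀ {m} (f : Fin (suc m) → Bool) → f (fromℕ m) ≡ true → Monic m (PF2 f)
  PF2-monic f top≡true = toList (tabulate (f ∘ inject₁)) , VP.length-toList (tabulate (f ∘ inject₁)) ,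
    trans (toList-tabulate-last f) (cong (λ t → toList (tabulate (f ∘ inject₁)) ++ t ∷ []) top≡true)

open BinaryPolynomials

sumF2-cong : ∀ {m} {f g : Fin m → Bool} → f ≗ g → sumF2 f ≡ sumF2 g
sumF2-cong {zero}  f≗g = refl
sumF2-cong {suc m} f≗g = cong₂ _xor_ (f≗g Fin.zero) (sumF2-cong (f≗g ∘ Fin.suc))

sumF2-xor : ∀ {m} (f g : Fin m → Bool) → sumF2 (λ l → f l xor g l) ≡ sumF2 f xor sumF2 g
sumF2-xor {zero}  f g = refl
sumF2-xor {suc m} f g = trans (cong ((f Fin.zero xor g Fin.zero) xor_) (sumF2-xor (f ∘ Fin.suc) (g ∘ Fin.suc)))
                              (F₂.+-interchange (f Fin.zero) (g Fin.zero) (sumF2 (f ∘ Fin.suc)) (sumF2 (g ∘ Fin.suc)))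

sumF2-zero : ∀ {m} (f : Fin m → Bool) → (∀ l → f l ≡ false) → sumF2 f ≡ false
sumF2-zero {zero}  f f≡0 = refl
sumF2-zero {suc m} f f≡0 = cong₂ _xor_ (f≡0 Fin.zero) (sumF2-zero (f ∘ Fin.suc) (f≡0 ∘ Fin.suc))

sumF2-∧ : ∀ {m} a (f : Fin m → Bool) → sumF2 (λ l → a ∧ f l) ≡ a ∧ sumF2 f
sumF2-∧ false f = sumF2-zero (λ l → false ∧ f l) (λ _ → refl)
sumF2-∧ true  f = refl

sumF2-single : ∀ {m} (f : Fin m → Bool) l₀ → (∀ l → l ≢ l₀ → f l ≡ false) → sumF2 f ≡ f l₀
sumF2-single f Fin.zero     off = trans (cong (f Fin.zero xor_) (sumF2-zero (f ∘ Fin.suc) λ l → off (Fin.suc l) λ ())) (xor-identityʳ _)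
sumF2-single f (Fin.suc l₀) off = trans (cong (_xor sumF2 (f ∘ Fin.suc)) (off Fin.zero λ ()))
                                        (sumF2-single (f ∘ Fin.suc) l₀ λ l l≢l₀ → off (Fin.suc l) (l≢l₀ ∘ FinP.suc-injective))

module Companion {k′ : ℕ} (b : Fin (suc (suc k′)) → Bool) where

  open F₂ using (_≈_; mk≈; coeff-≡; ≈-sym; Monic)
  open PolyF2 using (add; mul; scale; coeff; monomial)

  k : ℕ
  k = suc k′

  A : Mat k
  A = companion b

  V : Set
  V = Fin k → Bool

  0ᵥ : V
  0ᵥ _ = false

  infixl 6 _⊕_
  _⊕_ : V → V → V
  (u ⊕ w) i = u i xor w i

  infixr 7 _·_
  _·_ : Bool → V → V
  (c · w) i = c ∧ w i

  e₀ : V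
  e₀ i = idM i Fin.zero

  last : Fin k
  last = fromℕ k′

  shift : V → V
  shift w Fin.zero    = false
  shift w (Fin.suc i) = w (inject₁ i)

  applyA : V → V
  applyA w i = sumF2 (λ l → A i l ∧ w l)

  private
    isLast : Fin k → Bool
    isLast l with toℕ l ℕ.≟ k′
    ... | yes _ = true
    ... | no  _ = false

    isPred : Fin k → Fin k → Bool
    isPred i l with toℕ l ℕ.≟ k′
    ... | yes _ = false
    ... | no  _ with toℕ i ℕ.≟ suc (toℕ l)
    ...   | yes _ = true
    ...   | no  _ = false

    A-split : ∀ (w : V) i l → A i l ∧ w l ≡ (isLast l ∧ (b (inject₁ i) ∧ w l)) xor (isPred i l ∧ w l)
    A-split w i l with toℕ l ℕ.≟ k′
    ... | yes _ = sym (xor-identityʳ _)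
    ... | no  _ with toℕ i ℕ.≟ suc (toℕ l)
    ...   | yes _ = refl
    ...   | no  _ = refl

    sum-isLast : ∀ (x : V) → sumF2 (λ l → isLast l ∧ x l) ≡ x last
    sum-isLast x = trans (sumF2-single (λ l → isLast l ∧ x l) last off) (cong (_∧ x last) isLast-last)
      where
        isLast-last : isLast last ≡ true
        isLast-last with toℕ last ℕ.≟ k′
        ... | yes _    = refl
        ... | no  ≢k′ = ⊥-elim (≢k′ (FinP.toℕ-fromℕ k′))
        off : ∀ l → l ≢ last → isLast l ∧ x l ≡ false
        off l l≢last with toℕ l ℕ.≟ k′
        ... | yes ≡k′ = ⊥-elim (l≢last (FinP.toℕ-injective (trans ≡k′ (sym (FinP.toℕ-fromℕ k′)))))
        ... | no  _   = refl

    sum-isPred : ∀ (w : V) i → sumF2 (λ l → isPred i l ∧ w l) ≡ shift w i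
    sum-isPred w Fin.zero = sumF2-zero (λ l → isPred Fin.zero l ∧ w l) off
      where
        off : ∀ l → isPred Fin.zero l ∧ w l ≡ false
        off l with toℕ l ℕ.≟ k′
        ... | yes _ = refl
        ... | no  _ = refl
    sum-isPred w (Fin.suc i) = trans (sumF2-single (λ l → isPred (Fin.suc i) l ∧ w l) (inject₁ i) off) on
      where
        off : ∀ l → l ≢ inject₁ i → isPred (Fin.suc i) l ∧ w l ≡ false
        off l l≢i with toℕ l ℕ.≟ k′
        ... | yes _ = refl
        ... | no  _ with suc (toℕ i) ℕ.≟ suc (toℕ l)
        ...   | yes i≡l = ⊥-elim (l≢i (FinP.toℕ-injective (trans (sym (ℕP.suc-injective i≡l)) (sym (FinP.toℕ-inject₁ i)))))
        ...   | no  _   = refl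
        on : isPred (Fin.suc i) (inject₁ i) ∧ w (inject₁ i) ≡ w (inject₁ i)
        on with toℕ (inject₁ i) ℕ.≟ k′
        ... | yes ≡k′ = ⊥-elim (ℕP.<⇒≢ (subst (ℕ._< k′) (sym (FinP.toℕ-inject₁ i)) (FinP.toℕ<n i)) ≡k′)
        ... | no  _ with suc (toℕ i) ℕ.≟ suc (toℕ (inject₁ i))
        ...   | yes _   = refl
        ...   | no  i≢i = ⊥-elim (i≢i (cong suc (sym (FinP.toℕ-inject₁ i))))

  applyA-companion : ∀ (w : V) i → applyA w i ≡ shift w i xor (b (inject₁ i) ∧ w last)
  applyA-companion w i = begin
    applyA w i                          ≡⟨ sumF2-cong (A-split w i) ⟩
    sumF2 (λ l → L l xor S l)           ≡⟨ sumF2-xor L S ⟩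
    sumF2 L xor sumF2 S                 ≡⟨ xor-comm (sumF2 L) (sumF2 S) ⟩
    sumF2 S xor sumF2 L                 ≡⟨ cong₂ _xor_ (sum-isPred w i) (sum-isLast (b (inject₁ i) · w)) ⟩
    shift w i xor (b (inject₁ i) ∧ w last) ∎
    where
      open ≡-Reasoning
      L S : Fin k → Bool
      L l = isLast l ∧ (b (inject₁ i) ∧ w l)
      S l = isPred i l ∧ w l

  applyA-cong : ∀ {u w} → u ≗ w → applyA u ≗ applyA w
  applyA-cong u≗w i = sumF2-cong (λ l → cong (A i l ∧_) (u≗w l))

  applyA-⊕ : ∀ u w → applyA (u ⊕ w) ≗ applyA u ⊕ applyA w
  applyA-⊕ u w i = trans (sumF2-cong (λ l → ∧-distribˡ-xor (A i l) (u l) (w l))) (sumF2-xor (λ l → A i l ∧ u l) (λ l → A i l ∧ w l))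

  applyA-0 : applyA 0ᵥ ≗ 0ᵥ
  applyA-0 i = sumF2-zero (λ l → A i l ∧ false) (λ l → ∧-zeroʳ (A i l))

  applyA-· : ∀ c w → applyA (c · w) ≗ c · applyA w
  applyA-· c w i = trans (sumF2-cong (λ l → ∧-swap (A i l) c (w l))) (sumF2-∧ c (λ l → A i l ∧ w l))
    where
      ∧-swap : ∀ x y z → x ∧ (y ∧ z) ≡ y ∧ (x ∧ z)
      ∧-swap x y z = trans (sym (∧-assoc x y z)) (trans (cong (_∧ z) (∧-comm x y)) (∧-assoc y x z))

  evalA : List Bool → V → V
  evalA []      w = 0ᵥ
  evalA (c ∷ p) w = c · w ⊕ applyA (evalA p w)

  evalA-cong : ∀ p {u w} → u ≗ w → evalA p u ≗ evalA p w
  evalA-cong []      u≗w i = refl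
  evalA-cong (c ∷ p) u≗w i = cong₂ (λ x y → (c ∧ x) xor y) (u≗w i) (applyA-cong (evalA-cong p u≗w) i)

  evalA-⊕ : ∀ p u w → evalA p (u ⊕ w) ≗ evalA p u ⊕ evalA p w
  evalA-⊕ []      u w i = refl
  evalA-⊕ (c ∷ p) u w i = begin
    (c ∧ (u i xor w i)) xor applyA (evalA p (u ⊕ w)) i
      ≡⟨ cong₂ _xor_ (∧-distribˡ-xor c (u i) (w i)) (trans (applyA-cong (evalA-⊕ p u w) i) (applyA-⊕ (evalA p u) (evalA p w) i)) ⟩
    ((c ∧ u i) xor (c ∧ w i)) xor (applyA (evalA p u) i xor applyA (evalA p w) i)
      ≡⟨ F₂.+-interchange (c ∧ u i) (c ∧ w i) _ _ ⟩
    (evalA (c ∷ p) u ⊕ evalA (c ∷ p) w) i ∎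
    where open ≡-Reasoning

  evalA-0 : ∀ p → evalA p 0ᵥ ≗ 0ᵥ
  evalA-0 []      i = refl
  evalA-0 (c ∷ p) i = cong₂ _xor_ (∧-zeroʳ c) (trans (applyA-cong (evalA-0 p) i) (applyA-0 i))

  evalA-· : ∀ c p w → evalA p (c · w) ≗ c · evalA p w
  evalA-· true  p w i = refl
  evalA-· false p w i = evalA-0 p i

  evalA-applyA : ∀ p w → evalA p (applyA w) ≗ applyA (evalA p w)
  evalA-applyA []      w i = sym (applyA-0 i)
  evalA-applyA (c ∷ p) w i =
    trans (cong₂ _xor_ (sym (applyA-· c w i)) (applyA-cong (evalA-applyA p w) i))
          (sym (applyA-⊕ (c · w) (applyA (evalA p w)) i))

  evalA-comm : ∀ p q w → evalA p (evalA q w) ≗ evalA q (evalA p w)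
  evalA-comm p []      w i = evalA-0 p i
  evalA-comm p (c ∷ q) w i = trans (evalA-⊕ p (c · w) (applyA (evalA q w)) i)
    (cong₂ _xor_ (evalA-· c p w i) (trans (evalA-applyA p (evalA q w) i) (applyA-cong (evalA-comm p q w) i)))

  evalA-add : ∀ p q w → evalA (add p q) w ≗ evalA p w ⊕ evalA q w
  evalA-add []      q       w i = refl
  evalA-add (a ∷ p) []      w i = sym (xor-identityʳ _)
  evalA-add (a ∷ p) (c ∷ q) w i = begin
    ((a xor c) ∧ w i) xor applyA (evalA (add p q) w) i
      ≡⟨ cong₂ _xor_ (∧-distribʳ-xor (w i) a c) (trans (applyA-cong (evalA-add p q w) i) (applyA-⊕ (evalA p w) (evalA q w) i)) ⟩
    ((a ∧ w i) xor (c ∧ w i)) xor (applyA (evalA p w) i xor applyA (evalA q w) i)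
      ≡⟨ F₂.+-interchange (a ∧ w i) (c ∧ w i) _ _ ⟩
    (evalA (a ∷ p) w ⊕ evalA (c ∷ q) w) i ∎
    where open ≡-Reasoning

  evalA-scale : ∀ a p w → evalA (scale a p) w ≗ a · evalA p w
  evalA-scale a []      w i = sym (∧-zeroʳ a)
  evalA-scale a (c ∷ p) w i =
    trans (cong₂ _xor_ (∧-assoc a c (w i)) (trans (applyA-cong (evalA-scale a p w) i) (applyA-· a (evalA p w) i)))
          (sym (∧-distribˡ-xor a (c ∧ w i) (applyA (evalA p w) i)))

  evalA-mul : ∀ p q w → evalA (mul p q) w ≗ evalA p (evalA q w)
  evalA-mul []      q w i = refl
  evalA-mul (a ∷ p) q w i = trans (evalA-add (scale a q) (false ∷ mul p q) w i)
    (cong₂ _xor_ (evalA-scale a q w i) (applyA-cong (evalA-mul p q w) i))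

  evalA-≈[] : ∀ p w → p ≈ [] → evalA p w ≗ 0ᵥ
  evalA-≈[] []      w p≈0 i = refl
  evalA-≈[] (c ∷ p) w p≈0 i = cong₂ _xor_ (cong (_∧ w i) (coeff-≡ p≈0 0))
    (trans (applyA-cong (evalA-≈[] p w (F₂.∷-≈[]-tail p≈0)) i) (applyA-0 i))

  evalA-≈ : ∀ {p q} w → p ≈ q → evalA p w ≗ evalA q w
  evalA-≈ {[]}    {q}     w p≈q i = sym (evalA-≈[] q w (≈-sym p≈q) i)
  evalA-≈ {c ∷ p} {[]}    w p≈q i = evalA-≈[] (c ∷ p) w p≈q i
  evalA-≈ {c ∷ p} {d ∷ q} w p≈q i = cong₂ (λ x y → (x ∧ w i) xor y) (coeff-≡ p≈q 0)
    (applyA-cong (evalA-≈ w (F₂.∷-≈-tail p≈q)) i)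

  -- e₀ is a cyclic vector: p(A) e₀ has the coefficients of p as coordinates.
  evalA₀ : List Bool → V
  evalA₀ p = evalA p e₀

  applyA-shift : ∀ w → w last ≡ false → applyA w ≗ shift w
  applyA-shift w w-last≡0 i = begin
    applyA w i                                ≡⟨ applyA-companion w i ⟩
    shift w i xor (b (inject₁ i) ∧ w last)    ≡⟨ cong (λ x → shift w i xor (b (inject₁ i) ∧ x)) w-last≡0 ⟩
    shift w i xor (b (inject₁ i) ∧ false)     ≡⟨ cong (shift w i xor_) (∧-zeroʳ _) ⟩
    shift w i xor false                       ≡⟨ xor-identityʳ _ ⟩
    shift w i                                 ∎
    where open ≡-Reasoning

  evalA₀-coeff : ∀ R → length R ≤ k → ∀ i → evalA₀ R i ≡ coeff R (toℕ i)
  evalA₀-coeff []      _         i = refl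
  evalA₀-coeff (c ∷ R) (s≤s R≤k′) i =
    trans (cong ((c ∧ e₀ i) xor_) (applyA-shift (evalA₀ R) R-last≡0 i)) (coordinate i)
    where
      R≤k : length R ≤ k
      R≤k = ℕP.m≤n⇒m≤1+n R≤k′
      R-last≡0 : evalA₀ R last ≡ false
      R-last≡0 = trans (evalA₀-coeff R R≤k last)
                       (F₂.coeff-beyond R (subst (length R ≤_) (sym (FinP.toℕ-fromℕ k′)) R≤k′))
      coordinate : ∀ i → (c ∧ e₀ i) xor shift (evalA₀ R) i ≡ coeff (c ∷ R) (toℕ i)
      coordinate Fin.zero    = trans (xor-identityʳ _) (∧-identityʳ c)
      coordinate (Fin.suc i) = begin
        (c ∧ false) xor evalA₀ R (inject₁ i)  ≡⟨ cong (_xor _) (∧-zeroʳ c) ⟩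
        evalA₀ R (inject₁ i)                  ≡⟨ evalA₀-coeff R R≤k (inject₁ i) ⟩
        coeff R (toℕ (inject₁ i))             ≡⟨ cong (coeff R) (FinP.toℕ-inject₁ i) ⟩
        coeff R (toℕ i)                       ∎
        where open ≡-Reasoning

  coordinates : ∀ w → w ≗ evalA₀ (toList (tabulate w))
  coordinates w j = sym (trans (evalA₀-coeff (toList (tabulate w)) (ℕP.≤-reflexive (VP.length-toList (tabulate w))) j)
                               (coeff-tabulate w j))

  iterA : ℕ → V → V
  iterA zero    w = w
  iterA (suc m) w = applyA (iterA m w)

  iterA-cong : ∀ m {u w} → u ≗ w → iterA m u ≗ iterA m w
  iterA-cong zero    u≗w = u≗w
  iterA-cong (suc m) u≗w = applyA-cong (iterA-cong m u≗w)

  iterA-+ : ∀ m m′ w → iterA (m ℕ.+ m′) w ≗ iterA m (iterA m′ w)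
  iterA-+ zero    m′ w i = refl
  iterA-+ (suc m) m′ w   = applyA-cong (iterA-+ m m′ w)

  iterA-comm : ∀ m m′ w → iterA m (iterA m′ w) ≗ iterA m′ (iterA m w)
  iterA-comm m m′ w i = begin
    iterA m (iterA m′ w) i   ≡⟨ iterA-+ m m′ w i ⟨
    iterA (m ℕ.+ m′) w i     ≡⟨ cong (λ t → iterA t w i) (ℕP.+-comm m m′) ⟩
    iterA (m′ ℕ.+ m) w i     ≡⟨ iterA-+ m′ m w i ⟩
    iterA m′ (iterA m w) i   ∎
    where open ≡-Reasoning

  powM-column : ∀ m i j → powM A m i j ≡ iterA m (λ l → idM l j) i
  powM-column zero    i j = refl
  powM-column (suc m) i j = sumF2-cong (λ l → cong (A i l ∧_) (powM-column m l j))

  evalA₀-monomial : ∀ m → evalA₀ (monomial true m) ≗ iterA m e₀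
  evalA₀-monomial zero    i = trans (cong ((true ∧ e₀ i) xor_) (applyA-0 i)) (xor-identityʳ _)
  evalA₀-monomial (suc m) i = applyA-cong (evalA₀-monomial m) i

  idM-column : ∀ j → (λ l → idM l j) ≗ iterA (toℕ j) e₀
  idM-column j l = begin
    idM l j                                   ≡⟨ entry ⟩
    coeff (monomial true (toℕ j)) (toℕ l)     ≡⟨ evalA₀-coeff (monomial true (toℕ j)) X^j≤k l ⟨
    evalA₀ (monomial true (toℕ j)) l          ≡⟨ evalA₀-monomial (toℕ j) l ⟩
    iterA (toℕ j) e₀ l                        ∎
    where
      open ≡-Reasoning
      X^j≤k : length (monomial true (toℕ j)) ≤ k
      X^j≤k = subst (_≤ k) (sym (F₂.length-monomial true (toℕ j))) (FinP.toℕ<n j)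
      entry : idM l j ≡ coeff (monomial true (toℕ j)) (toℕ l)
      entry with l FinP.≟ j
      ... | yes refl = sym (F₂.coeff-monomial-≡ true (toℕ l))
      ... | no  l≢j  = sym (F₂.coeff-monomial-≢ true (toℕ j) (l≢j ∘ FinP.toℕ-injective))

  evalA₀-XnPlus1 : ∀ n → evalA₀ (XnPlus1 n) ≗ e₀ ⊕ iterA n e₀
  evalA₀-XnPlus1 n i = trans (evalA-add (true ∷ []) (monomial true n) e₀ i)
                             (cong₂ _xor_ (evalA₀-monomial 0 i) (evalA₀-monomial n i))

  iterA-e₀⇒powM : ∀ n → iterA n e₀ ≗ e₀ → powM A n ≡M idM
  iterA-e₀⇒powM n fixed i j = begin
    powM A n i j                       ≡⟨ powM-column n i j ⟩
    iterA n (λ l → idM l j) i          ≡⟨ iterA-cong n (idM-column j) i ⟩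
    iterA n (iterA (toℕ j) e₀) i       ≡⟨ iterA-comm n (toℕ j) e₀ i ⟩
    iterA (toℕ j) (iterA n e₀) i       ≡⟨ iterA-cong (toℕ j) fixed i ⟩
    iterA (toℕ j) e₀ i                 ≡⟨ idM-column j i ⟨
    idM i j                            ∎
    where open ≡-Reasoning

  powM⇒iterA-e₀ : ∀ n → powM A n ≡M idM → iterA n e₀ ≗ e₀
  powM⇒iterA-e₀ n A^n≡I i = trans (sym (powM-column n i Fin.zero)) (A^n≡I i Fin.zero)

  module _ (b-top : b (fromℕ k) ≡ true) where

    P : List Bool
    P = PF2 b

    evalA₀-P : evalA₀ P ≗ 0ᵥ
    evalA₀-P i = begin
      (b Fin.zero ∧ e₀ i) xor applyA (evalA₀ R′) i
        ≡⟨ cong ((b Fin.zero ∧ e₀ i) xor_) (applyA-companion (evalA₀ R′) i) ⟩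
      (b Fin.zero ∧ e₀ i) xor (shift (evalA₀ R′) i xor (b (inject₁ i) ∧ evalA₀ R′ last))
        ≡⟨ cong (λ x → (b Fin.zero ∧ e₀ i) xor (shift (evalA₀ R′) i xor (b (inject₁ i) ∧ x))) (trans (R′-coeff last) b-top) ⟩
      (b Fin.zero ∧ e₀ i) xor (shift (evalA₀ R′) i xor (b (inject₁ i) ∧ true))
        ≡⟨ cancel i ⟩
      false ∎
      where
        open ≡-Reasoning
        R′ : List Bool
        R′ = toList (tabulate (b ∘ Fin.suc))
        R′-coeff : ∀ j → evalA₀ R′ j ≡ b (Fin.suc j)
        R′-coeff j = sym (coordinates (b ∘ Fin.suc) j)
        cancel : ∀ i → (b Fin.zero ∧ e₀ i) xor (shift (evalA₀ R′) i xor (b (inject₁ i) ∧ true)) ≡ false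
        cancel Fin.zero    = trans (cong₂ _xor_ (∧-identityʳ (b Fin.zero)) (∧-identityʳ (b Fin.zero))) (xor-same (b Fin.zero))
        cancel (Fin.suc i) = trans (cong₂ _xor_ (∧-zeroʳ (b Fin.zero)) (cong₂ _xor_ (R′-coeff (inject₁ i)) (∧-identityʳ bᵢ)))
                                   (xor-same bᵢ)
          where bᵢ = b (Fin.suc (inject₁ i))

    evalA-P : ∀ w → evalA P w ≗ 0ᵥ
    evalA-P w i = begin
      evalA P w i                                 ≡⟨ evalA-cong P (coordinates w) i ⟩
      evalA P (evalA₀ W) i                        ≡⟨ evalA-comm P W e₀ i ⟩
      evalA W (evalA₀ P) i                        ≡⟨ evalA-cong W evalA₀-P i ⟩
      evalA W 0ᵥ i                                ≡⟨ evalA-0 W i ⟩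
      false                                       ∎
      where
        open ≡-Reasoning
        W : List Bool
        W = toList (tabulate w)

    evalA₀-mul-P : ∀ Q → evalA₀ (mul P Q) ≗ 0ᵥ
    evalA₀-mul-P Q i = trans (evalA-mul P Q e₀ i) (evalA-P (evalA₀ Q) i)

    open Division (PF2-monic b b-top)

    ∣⇒iterA-e₀ : ∀ n → P ∣F2 XnPlus1 n → iterA n e₀ ≗ e₀
    ∣⇒iterA-e₀ n (r , Pr≈) i = sym (xor≡false⇒≡ (e₀ i) (iterA n e₀ i) (begin
      e₀ i xor iterA n e₀ i      ≡⟨ evalA₀-XnPlus1 n i ⟨
      evalA₀ (XnPlus1 n) i       ≡⟨ evalA-≈ {XnPlus1 n} {mul P r} e₀ (≈-sym (mk≈ Pr≈)) i ⟩
      evalA₀ (mul P r) i         ≡⟨ evalA₀-mul-P r i ⟩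
      false                      ∎))
      where open ≡-Reasoning

    iterA-e₀⇒∣ : ∀ n → iterA n e₀ ≗ e₀ → P ∣F2 XnPlus1 n
    iterA-e₀⇒∣ n fixed with divMod (XnPlus1 n)
    ... | Q , R , R≤k , X≈ = remainder-≈[]⇒∣ Q R X≈ (mk≈ R-coeff)
      where
        evalA₀-R : evalA₀ R ≗ 0ᵥ
        evalA₀-R i = begin
          evalA₀ R i                               ≡⟨ cong (_xor evalA₀ R i) (evalA₀-mul-P Q i) ⟨
          evalA₀ (mul P Q) i xor evalA₀ R i        ≡⟨ evalA-add (mul P Q) R e₀ i ⟨
          evalA₀ (add (mul P Q) R) i               ≡⟨ evalA-≈ e₀ X≈ i ⟨
          evalA₀ (XnPlus1 n) i                     ≡⟨ evalA₀-XnPlus1 n i ⟩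
          e₀ i xor iterA n e₀ i                    ≡⟨ cong (e₀ i xor_) (fixed i) ⟩
          e₀ i xor e₀ i                            ≡⟨ xor-same (e₀ i) ⟩
          false                                    ∎
          where open ≡-Reasoning
        R-coeff : ∀ j → coeff R j ≡ false
        R-coeff j with j ℕ.<? k
        ... | yes j<k = trans (cong (coeff R) (sym (FinP.toℕ-fromℕ< j<k)))
                              (trans (sym (evalA₀-coeff R R≤k (Fin.fromℕ< j<k))) (evalA₀-R _))
        ... | no  j≮k = F₂.coeff-beyond R (ℕP.≤-trans R≤k (ℕP.≮⇒≥ j≮k))

    powM≡I⇔∣ : ∀ n → (powM A n ≡M idM) ⇔ (P ∣F2 XnPlus1 n)
    powM≡I⇔∣ n = mk⇔ (iterA-e₀⇒∣ n ∘ powM⇒iterA-e₀ n) (iterA-e₀⇒powM n ∘ ∣⇒iterA-e₀ n)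

extend : ∀ {k} → Vec Bool k → List (Vec Bool (suc k))
extend s = (false ∷ s) ∷ (true ∷ s) ∷ []

length-allSubsets : ∀ k → length (allSubsets k) ≡ 2 ^ k
length-allSubsets zero    = refl
length-allSubsets (suc k) = trans (doubles (allSubsets k)) (cong (λ m → m ℕ.+ (m ℕ.+ 0)) (length-allSubsets k))
  where
    doubles : ∀ (xs : List (Vec Bool k)) → length (concatMap extend xs) ≡ length xs ℕ.+ (length xs ℕ.+ 0)
    doubles []       = refl
    doubles (x ∷ xs) = cong suc (trans (cong suc (doubles xs)) (sym (ℕP.+-suc (length xs) (length xs ℕ.+ 0))))

∈-allSubsets : ∀ {k} (S : Vec Bool k) → S ∈ allSubsets k
∈-allSubsets []      = here refl
∈-allSubsets (x ∷ S) = ∈-extend x (∈-allSubsets S)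
  where
    ∈-extend : ∀ {k} x {s : Vec Bool k} {xs} → s ∈ xs → (x ∷ s) ∈ concatMap extend xs
    ∈-extend false (here refl) = here refl
    ∈-extend true  (here refl) = there (here refl)
    ∈-extend x {xs = y ∷ ys} (there s∈ys) = there (there (∈-extend x s∈ys))

allSubsets-unique : ∀ k → Unique (allSubsets k)
allSubsets-unique zero    = [] ∷ []
allSubsets-unique (suc k) = extend-unique (allSubsets-unique k)
  where
    ∷-≢ : ∀ {a c : Bool} {s t : Vec Bool k} → s ≢ t → (a ∷ s) ≢ (c ∷ t)
    ∷-≢ s≢t refl = s≢t refl
    all-extend : ∀ {s xs} → All (s ≢_) xs → ∀ {a} → All ((a ∷ s) ≢_) (concatMap extend xs)
    all-extend []           = []
    all-extend (s≢t ∷ s≢ts) = ∷-≢ s≢t ∷ ∷-≢ s≢t ∷ all-extend s≢ts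
    extend-unique : ∀ {xs} → Unique xs → Unique (concatMap extend xs)
    extend-unique []             = []
    extend-unique (s≢xs ∷ xs-un) = ((λ ()) ∷ all-extend s≢xs) ∷ all-extend s≢xs ∷ extend-unique xs-un

allSubsets-head : ∀ k → Σ (List (Vec Bool k)) λ rest → allSubsets k ≡ Vec.replicate k false ∷ rest
allSubsets-head zero = [] , refl
allSubsets-head (suc k) with allSubsets k | allSubsets-head k
... | _ | rest , refl = (true ∷ Vec.replicate k false) ∷ concatMap extend rest , refl

module FieldFacts {n : ℕ} (F : FiniteField n) where

  open FiniteField F public using (Carrier)
  open FiniteField F using (0≢1; inverse; card; isCommutativeRing)
  open Polynomials isCommutativeRing public
  open InField F public using (pow; Finv; embed; lin; LinIndep; sumList; affineSum; SumFree; SplitsSimple; Lpoly)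
  open import Algebra.Properties.CommutativeMonoid.Sum (CommutativeRing.*-commutativeMonoid ring)
    using (sum-permute; ∑-distrib-+; sum-cong-≗) renaming (sum to Π)

  q : ℕ
  q = 2 ^ n

  toF : Fin q → Carrier
  toF = Inverse.to card

  fromF : Carrier → Fin q
  fromF = Inverse.from card

  toF-fromF : ∀ x → toF (fromF x) ≡ x
  toF-fromF = Inverse.strictlyInverseˡ card

  fromF-toF : ∀ i → fromF (toF i) ≡ i
  fromF-toF = Inverse.strictlyInverseʳ card

  toF-injective : ∀ {i j} → toF i ≡ toF j → i ≡ j
  toF-injective {i} {j} ti≡tj = trans (sym (fromF-toF i)) (trans (cong fromF ti≡tj) (fromF-toF j))

  fromF-injective : ∀ {x y} → fromF x ≡ fromF y → x ≡ y
  fromF-injective {x} {y} fx≡fy = trans (sym (toF-fromF x)) (trans (cong toF fx≡fy) (toF-fromF y))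

  infix 4 _≟_
  _≟_ : DecidableEquality Carrier
  x ≟ y = Dec.map′ fromF-injective (cong fromF) (fromF x FinP.≟ fromF y)

  elements : List Carrier
  elements = map toF (List.allFin q)

  elements-unique : Unique elements
  elements-unique = UniqueP.map⁺ toF-injective (UniqueP.allFin⁺ q)

  length-elements : length elements ≡ q
  length-elements = trans (LP.length-map toF (List.allFin q)) (LP.length-tabulate id)

  *-cancelˡ-nonzero : ∀ {x y z} → x ≢ 0# → x * y ≡ x * z → y ≡ z
  *-cancelˡ-nonzero {x} {y} {z} x≢0 xy≡xz with inverse x x≢0
  ... | x⁻¹ , xx⁻¹≡1 = begin
    y              ≡⟨ *-identityˡ y ⟨
    1# * y         ≡⟨ cong (_* y) x⁻¹x≡1 ⟨
    x⁻¹ * x * y    ≡⟨ *-assoc x⁻¹ x y ⟩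
    x⁻¹ * (x * y)  ≡⟨ cong (x⁻¹ *_) xy≡xz ⟩
    x⁻¹ * (x * z)  ≡⟨ *-assoc x⁻¹ x z ⟨
    x⁻¹ * x * z    ≡⟨ cong (_* z) x⁻¹x≡1 ⟩
    1# * z         ≡⟨ *-identityˡ z ⟩
    z              ∎
    where
      open ≡-Reasoning
      x⁻¹x≡1 : x⁻¹ * x ≡ 1#
      x⁻¹x≡1 = trans (*-comm x⁻¹ x) xx⁻¹≡1

  zero-divisor : ∀ x y → x * y ≡ 0# → x ≡ 0# ⊎ y ≡ 0#
  zero-divisor x y xy≡0 with x ≟ 0#
  ... | yes x≡0 = inj₁ x≡0
  ... | no  x≢0 = inj₂ (*-cancelˡ-nonzero x≢0 (trans xy≡0 (sym (zeroʳ x))))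

  *-nonzero : ∀ {x y} → x ≢ 0# → y ≢ 0# → x * y ≢ 0#
  *-nonzero x≢0 y≢0 xy≡0 = [ x≢0 , y≢0 ]′ (zero-divisor _ _ xy≡0)

  1≢0 : 1# ≢ 0#
  1≢0 = 0≢1 ∘ sym

  product-nonzero : ∀ {A : Set} (f : A → Carrier) {xs} → All (λ x → f x ≢ 0#) xs → product (map f xs) ≢ 0#
  product-nonzero f []               = 1≢0
  product-nonzero f (fx≢0 ∷ fxs≢0)  = *-nonzero fx≢0 (product-nonzero f fxs≢0)

  open RootBound zero-divisor public

  pow-+ : ∀ x a b → pow x (a ℕ.+ b) ≡ pow x a * pow x b
  pow-+ x zero    b = sym (*-identityˡ _)
  pow-+ x (suc a) b = trans (cong (x *_) (pow-+ x a b)) (sym (*-assoc x _ _))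

  pow-distrib : ∀ x y m → pow (x * y) m ≡ pow x m * pow y m
  pow-distrib x y zero    = sym (*-identityˡ 1#)
  pow-distrib x y (suc m) = trans (cong ((x * y) *_) (pow-distrib x y m)) (regroup x y (pow x m) (pow y m))
    where
      regroup : ∀ x y u v → (x * y) * (u * v) ≡ (x * u) * (y * v)
      regroup = solve 4 (λ x y u v → (x :* y) :* (u :* v) := (x :* u) :* (y :* v)) refl

  pow-double : ∀ x m → pow x (2 ℕ.* m) ≡ pow (x * x) m
  pow-double x m = begin
    pow x (m ℕ.+ (m ℕ.+ 0))   ≡⟨ cong (λ t → pow x (m ℕ.+ t)) (ℕP.+-identityʳ m) ⟩
    pow x (m ℕ.+ m)           ≡⟨ pow-+ x m m ⟩
    pow x m * pow x m         ≡⟨ pow-distrib x x m ⟨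
    pow (x * x) m             ∎
    where open ≡-Reasoning

  pow-one : ∀ m → pow 1# m ≡ 1#
  pow-one zero    = refl
  pow-one (suc m) = trans (*-identityˡ _) (pow-one m)

  *-cancelʳ-nonzero : ∀ {x y z} → z ≢ 0# → x * z ≡ y * z → x ≡ y
  *-cancelʳ-nonzero {x} {y} {z} z≢0 xz≡yz = *-cancelˡ-nonzero z≢0 (trans (*-comm z x) (trans xz≡yz (*-comm y z)))

  Π-nonzero : ∀ {m} (g : Fin m → Carrier) → (∀ i → g i ≢ 0#) → Π g ≢ 0#
  Π-nonzero {zero}  g g≢0 = 1≢0
  Π-nonzero {suc m} g g≢0 = *-nonzero (g≢0 Fin.zero) (Π-nonzero (g ∘ Fin.suc) (g≢0 ∘ Fin.suc))

  Π-const : ∀ m a → Π {m} (λ _ → a) ≡ pow a m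
  Π-const zero    a = refl
  Π-const (suc m) a = cong (a *_) (Π-const m a)

  Π-except : ∀ a {m} (i₀ : Fin m) (g : Fin m → Carrier) → g i₀ ≡ 1# → (∀ i → i ≢ i₀ → g i ≡ a) → a * Π g ≡ pow a m
  Π-except a {suc m} Fin.zero g g₀≡1 g≡a = cong (a *_) (begin
    g Fin.zero * Π (g ∘ Fin.suc)   ≡⟨ cong (_* Π (g ∘ Fin.suc)) g₀≡1 ⟩
    1# * Π (g ∘ Fin.suc)           ≡⟨ *-identityˡ _ ⟩
    Π (g ∘ Fin.suc)                ≡⟨ sum-cong-≗ (λ i → g≡a (Fin.suc i) λ ()) ⟩
    Π {m} (λ _ → a)                ≡⟨ Π-const m a ⟩
    pow a m                        ∎)
    where open ≡-Reasoning
  Π-except a {suc m} (Fin.suc i₀) g g₀≡1 g≡a = begin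
    a * (g Fin.zero * Π (g ∘ Fin.suc))  ≡⟨ cong (λ z → a * (z * Π (g ∘ Fin.suc))) (g≡a Fin.zero λ ()) ⟩
    a * (a * Π (g ∘ Fin.suc))           ≡⟨ cong (a *_) (Π-except a i₀ (g ∘ Fin.suc) g₀≡1 λ i i≢i₀ → g≡a (Fin.suc i) (i≢i₀ ∘ FinP.suc-injective)) ⟩
    a * pow a m                         ∎
    where open ≡-Reasoning

  nonzeroPart : Carrier → Carrier
  nonzeroPart y with y ≟ 0#
  ... | yes _ = 1#
  ... | no  _ = y

  nonzeroPart-nonzero : ∀ y → nonzeroPart y ≢ 0#
  nonzeroPart-nonzero y with y ≟ 0#
  ... | yes _   = 1≢0
  ... | no  y≢0 = y≢0

  scaling : ∀ {a} → a ≢ 0# → Permutation q q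
  scaling {a} a≢0 with inverse a a≢0
  ... | a⁻¹ , aa⁻¹≡1 = permutation (scaleBy a) (scaleBy a⁻¹) (scaleBy-inverse aa⁻¹≡1) (scaleBy-inverse (trans (*-comm a⁻¹ a) aa⁻¹≡1))
    where
      scaleBy : Carrier → Fin q → Fin q
      scaleBy b i = fromF (b * toF i)
      scaleBy-inverse : ∀ {b b′} → b′ * b ≡ 1# → ∀ i → scaleBy b′ (scaleBy b i) ≡ i
      scaleBy-inverse {b} {b′} b′b≡1 i = begin
        fromF (b′ * toF (fromF (b * toF i)))   ≡⟨ cong (λ z → fromF (b′ * z)) (toF-fromF _) ⟩
        fromF (b′ * (b * toF i))               ≡⟨ cong fromF (*-assoc b′ b (toF i)) ⟨
        fromF (b′ * b * toF i)                 ≡⟨ cong (λ z → fromF (z * toF i)) b′b≡1 ⟩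
        fromF (1# * toF i)                     ≡⟨ cong fromF (*-identityˡ _) ⟩
        fromF (toF i)                          ≡⟨ fromF-toF i ⟩
        i                                      ∎
        where open ≡-Reasoning

  toF-scaling : ∀ {a} (a≢0 : a ≢ 0#) i → toF (scaling a≢0 ⟨$⟩ʳ i) ≡ a * toF i
  toF-scaling {a} a≢0 i with inverse a a≢0
  ... | _ = toF-fromF (a * toF i)

  -- Multiplication by a permutes the field, so the product of all nonzero parts
  -- is unchanged, yet it picks up the factor a once for every nonzero element.
  fermat-nonzero : ∀ a → a ≢ 0# → pow a q ≡ a
  fermat-nonzero a a≢0 = sym (*-cancelʳ-nonzero (Π-nonzero H (nonzeroPart-nonzero ∘ toF)) (begin
    a * Π H                                 ≡⟨ cong (a *_) (sum-permute H (scaling a≢0)) ⟩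
    a * Π (H ∘ (scaling a≢0 ⟨$⟩ʳ_))         ≡⟨ cong (a *_) (sum-cong-≗ λ i → trans (cong nonzeroPart (toF-scaling a≢0 i)) (nonzeroPart-scale (toF i))) ⟩
    a * Π (λ i → c i * H i)                 ≡⟨ cong (a *_) (∑-distrib-+ c H) ⟩
    a * (Π c * Π H)                         ≡⟨ *-assoc a (Π c) (Π H) ⟨
    a * Π c * Π H                           ≡⟨ cong (_* Π H) (Π-except a (fromF 0#) c c-zero c-nonzero) ⟩
    pow a q * Π H                           ∎))
    where
      open ≡-Reasoning
      factor : Carrier → Carrier
      factor y with y ≟ 0#
      ... | yes _ = 1#
      ... | no  _ = a
      nonzeroPart-scale : ∀ y → nonzeroPart (a * y) ≡ factor y * nonzeroPart y
      nonzeroPart-scale y with y ≟ 0# | a * y ≟ 0#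
      ... | yes _   | yes _    = sym (*-identityˡ 1#)
      ... | yes y≡0 | no  ay≢0 = ⊥-elim (ay≢0 (trans (cong (a *_) y≡0) (zeroʳ a)))
      ... | no  y≢0 | yes ay≡0 = ⊥-elim (*-nonzero a≢0 y≢0 ay≡0)
      ... | no  _   | no  _    = refl
      H c : Fin q → Carrier
      H = nonzeroPart ∘ toF
      c = factor ∘ toF
      c-zero : c (fromF 0#) ≡ 1#
      c-zero with toF (fromF 0#) ≟ 0#
      ... | yes _  = refl
      ... | no  ≢0 = ⊥-elim (≢0 (toF-fromF 0#))
      c-nonzero : ∀ i → i ≢ fromF 0# → c i ≡ a
      c-nonzero i i≢0 with toF i ≟ 0#
      ... | yes ≡0 = ⊥-elim (i≢0 (toF-injective (trans ≡0 (sym (toF-fromF 0#)))))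
      ... | no  _  = refl

  Finv-0 : 2 ≤ n → Finv 0# ≡ 0#
  Finv-0 2≤n with ℕP.m≤n⇒∃[o]m+o≡n (ℕP.^-monoʳ-≤ 2 2≤n)
  ... | m , 4+m≡q = trans (cong (λ t → pow 0# (t ℕ.∸ 2)) (sym 4+m≡q)) (zeroˡ _)

  q≡1+ : Σ ℕ λ m → q ≡ suc m
  q≡1+ with ℕP.m≤n⇒∃[o]m+o≡n (ℕP.m^n>0 2 n)
  ... | m , 1+m≡q = m , sym 1+m≡q

  fermat : ∀ a → pow a q ≡ a
  fermat a with a ≟ 0#
  ... | no  a≢0 = fermat-nonzero a a≢0
  ... | yes refl with q≡1+
  ...   | m , q≡1+m = trans (cong (pow 0#) q≡1+m) (zeroˡ _)

  module Degree≥1 (1≤n : 1 ≤ n) where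

    q≡2+ : Σ ℕ λ m → q ≡ suc (suc m)
    q≡2+ with ℕP.m≤n⇒∃[o]m+o≡n (ℕP.^-monoʳ-≤ 2 1≤n)
    ... | m , 2+m≡q = m , sym 2+m≡q

    -1≡1 : - 1# ≡ 1#
    -1≡1 with ℕP.m≤n⇒∃[o]m+o≡n 1≤n
    ... | n′ , 1+n′≡n = begin
      - 1#                      ≡⟨ fermat (- 1#) ⟨
      pow (- 1#) q              ≡⟨ cong (λ t → pow (- 1#) (2 ^ t)) 1+n′≡n ⟨
      pow (- 1#) (2 ℕ.* 2 ^ n′) ≡⟨ pow-double (- 1#) (2 ^ n′) ⟩
      pow (- 1# * - 1#) (2 ^ n′) ≡⟨ cong (λ z → pow z (2 ^ n′)) (trans (-1*x≈-x (- 1#)) (-‿involutive 1#)) ⟩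
      pow 1# (2 ^ n′)           ≡⟨ pow-one (2 ^ n′) ⟩
      1#                        ∎
      where open ≡-Reasoning

    x+x≡0 : ∀ x → x + x ≡ 0#
    x+x≡0 x = begin
      x + x                   ≡⟨ cong₂ _+_ (*-identityʳ x) (*-identityʳ x) ⟨
      x * 1# + x * 1#         ≡⟨ distribˡ x 1# 1# ⟨
      x * (1# + 1#)           ≡⟨ cong (λ z → x * (1# + z)) -1≡1 ⟨
      x * (1# + - 1#)         ≡⟨ cong (x *_) (-‿inverseʳ 1#) ⟩
      x * 0#                  ≡⟨ zeroʳ x ⟩
      0#                      ∎
      where open ≡-Reasoning

    x+y≡0⇒x≡y : ∀ {x y} → x + y ≡ 0# → x ≡ y
    x+y≡0⇒x≡y {x} {y} x+y≡0 = begin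
      x                       ≡⟨ +-identityʳ x ⟨
      x + 0#                  ≡⟨ cong (x +_) (x+x≡0 y) ⟨
      x + (y + y)             ≡⟨ +-assoc x y y ⟨
      x + y + y               ≡⟨ cong (_+ y) x+y≡0 ⟩
      0# + y                  ≡⟨ +-identityˡ y ⟩
      y                       ∎
      where open ≡-Reasoning

    x*Finv-x≡1 : ∀ x → x ≢ 0# → x * Finv x ≡ 1#
    x*Finv-x≡1 x x≢0 with q≡2+
    ... | m , q≡2+m = *-cancelˡ-nonzero x≢0 (begin
      x * (x * Finv x)        ≡⟨ cong (λ t → x * (x * pow x (t ℕ.∸ 2))) q≡2+m ⟩
      pow x (suc (suc m))     ≡⟨ cong (pow x) q≡2+m ⟨
      pow x q                 ≡⟨ fermat x ⟩
      x                       ≡⟨ *-identityʳ x ⟨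
      x * 1#                  ∎)
      where open ≡-Reasoning

module Linearized {n : ℕ} (F : FiniteField n) (1≤n : 1 ≤ n) where

  open FieldFacts F public
  open Degree≥1 1≤n public

  frobenius : ∀ u w → (u + w) * (u + w) ≡ u * u + w * w
  frobenius u w = begin
    (u + w) * (u + w)                 ≡⟨ expand u w ⟩
    u * u + (u * w + u * w) + w * w   ≡⟨ cong (λ z → u * u + z + w * w) (x+x≡0 (u * w)) ⟩
    u * u + 0# + w * w                ≡⟨ cong (_+ w * w) (+-identityʳ (u * u)) ⟩
    u * u + w * w                     ∎
    where
      open ≡-Reasoning
      expand : ∀ u w → (u + w) * (u + w) ≡ u * u + (u * w + u * w) + w * w
      expand = solve 2 (λ u w → (u :+ w) :* (u :+ w) := u :* u :+ (u :* w :+ u :* w) :+ w :* w) refl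

  embed-idem : ∀ c → embed c * embed c ≡ embed c
  embed-idem true  = *-identityˡ 1#
  embed-idem false = zeroˡ 0#

  embed-xor : ∀ a c → embed (a xor c) ≡ embed a + embed c
  embed-xor false c     = sym (+-identityˡ _)
  embed-xor true  false = sym (+-identityʳ _)
  embed-xor true  true  = sym (x+x≡0 1#)

  embed-∧ : ∀ a c → embed (a ∧ c) ≡ embed a * embed c
  embed-∧ false c = sym (zeroˡ _)
  embed-∧ true  c = sym (*-identityˡ _)

  embed≡0 : ∀ {c} → embed c ≡ 0# → c ≡ false
  embed≡0 {false} _   = refl
  embed≡0 {true}  1≡0 = ⊥-elim (1≢0 1≡0)

  -- L p y = Σᵢ pᵢ y^(2^i), the linearized associate of p evaluated at y.
  L : List Bool → Carrier → Carrier
  L []      y = 0#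
  L (c ∷ p) y = embed c * y + L p (y * y)

  L-0 : ∀ p → L p 0# ≡ 0#
  L-0 []      = refl
  L-0 (c ∷ p) = trans (cong₂ _+_ (zeroʳ _) (trans (cong (L p) (zeroˡ 0#)) (L-0 p))) (+-identityˡ 0#)

  L-+ : ∀ p y z → L p (y + z) ≡ L p y + L p z
  L-+ []      y z = sym (+-identityˡ 0#)
  L-+ (c ∷ p) y z = begin
    embed c * (y + z) + L p ((y + z) * (y + z))
      ≡⟨ cong₂ _+_ (distribˡ (embed c) y z) (trans (cong (L p) (frobenius y z)) (L-+ p (y * y) (z * z))) ⟩
    (embed c * y + embed c * z) + (L p (y * y) + L p (z * z))
      ≡⟨ +-interchange _ _ _ _ ⟩
    L (c ∷ p) y + L (c ∷ p) z ∎
    where open ≡-Reasoning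

  L-square : ∀ p y → L p (y * y) ≡ L p y * L p y
  L-square []      y = sym (zeroˡ 0#)
  L-square (c ∷ p) y = sym (begin
    (embed c * y + L p (y * y)) * (embed c * y + L p (y * y))
      ≡⟨ frobenius (embed c * y) (L p (y * y)) ⟩
    (embed c * y) * (embed c * y) + L p (y * y) * L p (y * y)
      ≡⟨ cong₂ _+_ (trans (square-* (embed c) y) (cong (_* (y * y)) (embed-idem c))) (sym (L-square p (y * y))) ⟩
    embed c * (y * y) + L p ((y * y) * (y * y)) ∎)
    where
      open ≡-Reasoning
      square-* : ∀ u w → (u * w) * (u * w) ≡ (u * u) * (w * w)
      square-* = solve 2 (λ u w → (u :* w) :* (u :* w) := (u :* u) :* (w :* w)) refl

  L-embed : ∀ p c y → L p (embed c * y) ≡ embed c * L p y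
  L-embed p true  y = trans (cong (L p) (*-identityˡ y)) (sym (*-identityˡ _))
  L-embed p false y = trans (cong (L p) (zeroˡ y)) (trans (L-0 p) (sym (zeroˡ _)))

  L-add : ∀ p q y → L (F₂.add p q) y ≡ L p y + L q y
  L-add []      q       y = sym (+-identityˡ _)
  L-add (a ∷ p) []      y = sym (+-identityʳ _)
  L-add (a ∷ p) (c ∷ q) y = begin
    embed (a xor c) * y + L (F₂.add p q) (y * y)
      ≡⟨ cong₂ _+_ (trans (cong (_* y) (embed-xor a c)) (distribʳ y (embed a) (embed c))) (L-add p q (y * y)) ⟩
    (embed a * y + embed c * y) + (L p (y * y) + L q (y * y))
      ≡⟨ +-interchange _ _ _ _ ⟩
    L (a ∷ p) y + L (c ∷ q) y ∎
    where open ≡-Reasoning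

  L-scale : ∀ a q y → L (F₂.scale a q) y ≡ embed a * L q y
  L-scale a []      y = sym (zeroʳ _)
  L-scale a (c ∷ q) y = begin
    embed (a ∧ c) * y + L (F₂.scale a q) (y * y)   ≡⟨ cong₂ _+_ (cong (_* y) (embed-∧ a c)) (L-scale a q (y * y)) ⟩
    embed a * embed c * y + embed a * L q (y * y) ≡⟨ cong (_+ embed a * L q (y * y)) (*-assoc _ _ _) ⟩
    embed a * (embed c * y) + embed a * L q (y * y) ≡⟨ distribˡ (embed a) _ _ ⟨
    embed a * L (c ∷ q) y                       ∎
    where open ≡-Reasoning

  L-mul : ∀ p q y → L (F₂.mul p q) y ≡ L p (L q y)
  L-mul []      q y = refl
  L-mul (a ∷ p) q y = begin
    L (F₂.add (F₂.scale a q) (false ∷ F₂.mul p q)) y              ≡⟨ L-add (F₂.scale a q) (false ∷ F₂.mul p q) y ⟩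
    L (F₂.scale a q) y + (0# * y + L (F₂.mul p q) (y * y))     ≡⟨ cong₂ _+_ (L-scale a q y) (trans (cong (_+ L (F₂.mul p q) (y * y)) (zeroˡ y)) (+-identityˡ _)) ⟩
    embed a * L q y + L (F₂.mul p q) (y * y)                ≡⟨ cong (embed a * L q y +_) (trans (L-mul p q (y * y)) (cong (L p) (L-square q y))) ⟩
    embed a * L q y + L p (L q y * L q y)                ∎
    where open ≡-Reasoning

  L-comm : ∀ p q y → L p (L q y) ≡ L q (L p y)
  L-comm p []      y = L-0 p
  L-comm p (c ∷ q) y = begin
    L p (embed c * y + L q (y * y))              ≡⟨ L-+ p (embed c * y) (L q (y * y)) ⟩
    L p (embed c * y) + L p (L q (y * y))        ≡⟨ cong₂ _+_ (L-embed p c y) (L-comm p q (y * y)) ⟩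
    embed c * L p y + L q (L p (y * y))          ≡⟨ cong (λ z → embed c * L p y + L q z) (L-square p y) ⟩
    embed c * L p y + L q (L p y * L p y)        ∎
    where open ≡-Reasoning

  L-≈[] : ∀ p y → p F₂.≈ [] → L p y ≡ 0#
  L-≈[] []      y p≈0 = refl
  L-≈[] (c ∷ p) y p≈0 = begin
    embed c * y + L p (y * y)    ≡⟨ cong₂ (λ d z → embed d * y + z) (F₂.coeff-≡ p≈0 0) (L-≈[] p (y * y) (F₂.∷-≈[]-tail p≈0)) ⟩
    0# * y + 0#                  ≡⟨ +-identityʳ _ ⟩
    0# * y                       ≡⟨ zeroˡ y ⟩
    0#                           ∎
    where open ≡-Reasoning

  L-cong : ∀ {p q} y → p F₂.≈ q → L p y ≡ L q y
  L-cong {[]}    {q}     y p≈q = sym (L-≈[] q y (F₂.≈-sym p≈q))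
  L-cong {c ∷ p} {[]}    y p≈q = L-≈[] (c ∷ p) y p≈q
  L-cong {c ∷ p} {d ∷ q} y p≈q = cong₂ (λ u v → embed u * y + v) (F₂.coeff-≡ p≈q 0) (L-cong (y * y) (F₂.∷-≈-tail p≈q))

  L-monomial : ∀ m y → L (F₂.monomial true m) y ≡ pow y (2 ^ m)
  L-monomial zero    y = trans (+-identityʳ _) (trans (*-identityˡ y) (sym (*-identityʳ y)))
  L-monomial (suc m) y = begin
    0# * y + L (F₂.monomial true m) (y * y)    ≡⟨ trans (cong (_+ L (F₂.monomial true m) (y * y)) (zeroˡ y)) (+-identityˡ _) ⟩
    L (F₂.monomial true m) (y * y)             ≡⟨ L-monomial m (y * y) ⟩
    pow (y * y) (2 ^ m)                     ≡⟨ pow-double y (2 ^ m) ⟨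
    pow y (2 ^ suc m)                       ∎
    where open ≡-Reasoning

  L-XnPlus1 : ∀ y → L (XnPlus1 n) y ≡ 0#
  L-XnPlus1 y = begin
    L (XnPlus1 n) y                              ≡⟨ L-add (true ∷ []) (F₂.monomial true n) y ⟩
    L (true ∷ []) y + L (F₂.monomial true n) y      ≡⟨ cong₂ _+_ (L-monomial 0 y) (trans (L-monomial n y) (fermat y)) ⟩
    pow y 1 + y                                  ≡⟨ cong (_+ y) (*-identityʳ y) ⟩
    y + y                                        ≡⟨ x+x≡0 y ⟩
    0#                                           ∎
    where open ≡-Reasoning

  eval-monomial : ∀ c d x → eval (monomial c d) x ≡ c * pow x d
  eval-monomial c zero    x = trans (cong (c +_) (zeroʳ x)) (trans (+-identityʳ c) (sym (*-identityʳ c)))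
  eval-monomial c (suc d) x = begin
    0# + x * eval (monomial c d) x  ≡⟨ +-identityˡ _ ⟩
    x * eval (monomial c d) x       ≡⟨ cong (x *_) (eval-monomial c d x) ⟩
    x * (c * pow x d)               ≡⟨ x∙yz≈y∙xz x c (pow x d) ⟩
    c * (x * pow x d)               ∎
    where open ≡-Reasoning

  -- linPoly s p = Σᵢ pᵢ X^(2^(s+i)) ∈ F[X]; the shift s makes the recursion structural.
  linPoly : ℕ → List Bool → List Carrier
  linPoly s []      = []
  linPoly s (c ∷ p) = add (monomial (embed c) (2 ^ s)) (linPoly (suc s) p)

  eval-linPoly : ∀ s p x → eval (linPoly s p) x ≡ L p (pow x (2 ^ s))
  eval-linPoly s []      x = refl
  eval-linPoly s (c ∷ p) x = begin
    eval (linPoly s (c ∷ p)) x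
      ≡⟨ eval-add (monomial (embed c) (2 ^ s)) (linPoly (suc s) p) x ⟩
    eval (monomial (embed c) (2 ^ s)) x + eval (linPoly (suc s) p) x
      ≡⟨ cong₂ _+_ (eval-monomial (embed c) (2 ^ s) x) (eval-linPoly (suc s) p x) ⟩
    embed c * pow x (2 ^ s) + L p (pow x (2 ^ suc s))
      ≡⟨ cong (λ z → embed c * pow x (2 ^ s) + L p z) (trans (pow-double x (2 ^ s)) (pow-distrib x x (2 ^ s))) ⟩
    L (c ∷ p) (pow x (2 ^ s)) ∎
    where open ≡-Reasoning

  eval-linPoly₀ : ∀ p x → eval (linPoly 0 p) x ≡ L p x
  eval-linPoly₀ p x = trans (eval-linPoly 0 p x) (cong (L p) (*-identityʳ x))

  Lpoly≡linPoly : ∀ {k} (b : Fin (suc k) → Bool) → Lpoly b ≡ linPoly 0 (PF2 b)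
  Lpoly≡linPoly b = shifted b 0
    where
      shifted : ∀ {m} (f : Fin m → Bool) s →
                foldr add [] (toList (tabulate (λ i → monomial (embed (f i)) (2 ^ (s ℕ.+ toℕ i))))) ≡ linPoly s (toList (tabulate f))
      shifted {zero}  f s = refl
      shifted {suc m} f s = cong₂ add
        (cong (λ t → monomial (embed (f Fin.zero)) (2 ^ t)) (ℕP.+-identityʳ s))
        (trans (cong (foldr add [] ∘ toList)
                     (VP.tabulate-cong (λ i → cong (λ t → monomial (embed (f (Fin.suc i))) (2 ^ t)) (ℕP.+-suc s (toℕ i)))))
               (shifted (f ∘ Fin.suc) (suc s)))

  2^s<2^[1+s] : ∀ s → 2 ^ s < 2 ^ suc s
  2^s<2^[1+s] s = ℕP.^-monoʳ-< 2 (s≤s (s≤s z≤n)) (ℕP.n<1+n s)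

  length-monomial-2^ : ∀ c s {t} → s < t → length (monomial c (2 ^ s)) ≤ 2 ^ t
  length-monomial-2^ c s s<t = subst (_≤ _) (sym (length-monomial c (2 ^ s)))
                                     (ℕP.<-≤-trans (2^s<2^[1+s] s) (ℕP.^-monoʳ-≤ 2 s<t))

  linPoly-monic : ∀ c s → Monic (2 ^ (s ℕ.+ length c)) (linPoly s (c ++ true ∷ []))
  linPoly-monic [] s = subst₂ Monic (cong (2 ^_) (sym (ℕP.+-identityʳ s))) (sym (add-identityʳ _)) (monomial-monic (2 ^ s))
  linPoly-monic (x ∷ c) s = subst (λ t → Monic (2 ^ t) (linPoly s ((x ∷ c) ++ true ∷ []))) (sym (ℕP.+-suc s (length c)))
    (monic-add-low (monomial (embed x) (2 ^ s)) (length-monomial-2^ (embed x) s (s≤s (ℕP.m≤m+n s (length c))))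
                   (linPoly-monic c (suc s)))

  length-linPoly : ∀ s R → length (linPoly s R) ≤ 2 ^ (s ℕ.+ length R)
  length-linPoly s []      = z≤n
  length-linPoly s (c ∷ R) = subst (_≤ 2 ^ (s ℕ.+ suc (length R))) (sym (length-add (monomial (embed c) (2 ^ s)) (linPoly (suc s) R)))
    (ℕP.⊔-lub (length-monomial-2^ (embed c) s (subst (s <_) (sym (ℕP.+-suc s (length R))) (s≤s (ℕP.m≤m+n s (length R)))))
              (subst (λ t → length (linPoly (suc s) R) ≤ 2 ^ t) (sym (ℕP.+-suc s (length R))) (length-linPoly (suc s) R)))

  coeff-linPoly-low : ∀ s R {j} → j < 2 ^ s → coeff (linPoly s R) j ≡ 0#
  coeff-linPoly-low s []      j<2^s = refl
  coeff-linPoly-low s (c ∷ R) {j} j<2^s = begin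
    coeff (linPoly s (c ∷ R)) j
      ≡⟨ coeff-add (monomial (embed c) (2 ^ s)) (linPoly (suc s) R) j ⟩
    coeff (monomial (embed c) (2 ^ s)) j + coeff (linPoly (suc s) R) j
      ≡⟨ cong₂ _+_ (coeff-monomial-≢ (embed c) (2 ^ s) (ℕP.<⇒≢ j<2^s))
                   (coeff-linPoly-low (suc s) R (ℕP.<-trans j<2^s (2^s<2^[1+s] s))) ⟩
    0# + 0#
      ≡⟨ +-identityˡ 0# ⟩
    0# ∎
    where open ≡-Reasoning

  -- The coefficient of X^(2^s) in linPoly s (c ∷ R) is c, and the rest sits higher.
  linPoly-≈[] : ∀ s R → linPoly s R ≈ [] → R F₂.≈ []
  linPoly-≈[] s []      _   = F₂.≈-refl
  linPoly-≈[] s (c ∷ R) c∷R≈0 = F₂.∷-≈[] (embed≡0 c-coeff) (linPoly-≈[] (suc s) R R≈0)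
    where
      M : List Carrier
      M = monomial (embed c) (2 ^ s)
      c-coeff : embed c ≡ 0#
      c-coeff = begin
        embed c                                                 ≡⟨ +-identityʳ _ ⟨
        embed c + 0#                                            ≡⟨ cong₂ _+_ (coeff-monomial-≡ (embed c) (2 ^ s)) (coeff-linPoly-low (suc s) R (2^s<2^[1+s] s)) ⟨
        coeff M (2 ^ s) + coeff (linPoly (suc s) R) (2 ^ s)     ≡⟨ coeff-add M (linPoly (suc s) R) (2 ^ s) ⟨
        coeff (linPoly s (c ∷ R)) (2 ^ s)                       ≡⟨ coeff-≡ c∷R≈0 (2 ^ s) ⟩
        0#                                                      ∎
        where open ≡-Reasoning
      R≈0 : linPoly (suc s) R ≈ []
      R≈0 = mk≈ λ j → begin
        coeff (linPoly (suc s) R) j                  ≡⟨ +-identityˡ _ ⟨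
        0# + coeff (linPoly (suc s) R) j             ≡⟨ cong (_+ _) (trans (cong (λ d → coeff (monomial d (2 ^ s)) j) c-coeff) (coeff-monomial-0 (2 ^ s) j)) ⟨
        coeff M j + coeff (linPoly (suc s) R) j      ≡⟨ coeff-add M (linPoly (suc s) R) j ⟨
        coeff (linPoly s (c ∷ R)) j                  ≡⟨ coeff-≡ c∷R≈0 j ⟩
        0#                                           ∎
        where open ≡-Reasoning

  coeff-linPoly-2 : ∀ a₀ a₁ R → coeff (linPoly 0 (a₀ ∷ a₁ ∷ R)) 2 ≡ embed a₁
  coeff-linPoly-2 a₀ a₁ R = begin
    coeff (linPoly 0 (a₀ ∷ a₁ ∷ R)) 2
      ≡⟨ coeff-add (monomial (embed a₀) 1) (linPoly 1 (a₁ ∷ R)) 2 ⟩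
    0# + coeff (linPoly 1 (a₁ ∷ R)) 2
      ≡⟨ +-identityˡ _ ⟩
    coeff (linPoly 1 (a₁ ∷ R)) 2
      ≡⟨ coeff-add (monomial (embed a₁) 2) (linPoly 2 R) 2 ⟩
    coeff (monomial (embed a₁) 2) 2 + coeff (linPoly 2 R) 2
      ≡⟨ cong₂ _+_ (coeff-monomial-≡ (embed a₁) 2) (coeff-linPoly-low 2 R (s≤s (s≤s (s≤s z≤n)))) ⟩
    embed a₁ + 0#
      ≡⟨ +-identityʳ _ ⟩
    embed a₁ ∎
    where open ≡-Reasoning

  lin-zero : ∀ {k} (v : Vec Carrier k) → lin v (Vec.replicate k false) ≡ 0#
  lin-zero []      = refl
  lin-zero (x ∷ v) = trans (+-identityˡ _) (lin-zero v)

  lin-xor : ∀ {k} (v : Vec Carrier k) S T → lin v (Vec.zipWith _xor_ S T) ≡ lin v S + lin v T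
  lin-xor []      []      []      = sym (+-identityˡ 0#)
  lin-xor (x ∷ v) (a ∷ S) (c ∷ T) = trans (cong₂ _+_ (select-xor a c) (lin-xor v S T)) (+-interchange _ _ _ _)
    where
      select-xor : ∀ a c → (if a xor c then x else 0#) ≡ (if a then x else 0#) + (if c then x else 0#)
      select-xor false c     = sym (+-identityˡ _)
      select-xor true  false = sym (+-identityʳ _)
      select-xor true  true  = sym (x+x≡0 x)

  lin-injective : ∀ {k} (v : Vec Carrier k) → LinIndep v → ∀ {S T} → lin v S ≡ lin v T → S ≡ T
  lin-injective v indep {S} {T} vS≡vT = xor≡0⇒≡ S T (indep (Vec.zipWith _xor_ S T) (trans (lin-xor v S T) (≡⇒x+y≡0 vS≡vT)))
    where
      ≡⇒x+y≡0 : ∀ {x y} → x ≡ y → x + y ≡ 0#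
      ≡⇒x+y≡0 {x} refl = x+x≡0 x
      xor≡0⇒≡ : ∀ {k} (S T : Vec Bool k) → Vec.zipWith _xor_ S T ≡ Vec.replicate k false → S ≡ T
      xor≡0⇒≡ []      []      _  = refl
      xor≡0⇒≡ (a ∷ S) (c ∷ T) eq = cong₂ _∷_ (xor≡false⇒≡ a c (cong Vec.head eq)) (xor≡0⇒≡ S T (cong Vec.tail eq))

  span : ∀ {k} → Vec Carrier k → List Carrier
  span {k} v = map (lin v) (allSubsets k)

  span-unique : ∀ {k} (v : Vec Carrier k) → LinIndep v → Unique (span v)
  span-unique {k} v indep = UniqueP.map⁺ (lin-injective v indep) (allSubsets-unique k)

  length-span : ∀ {k} (v : Vec Carrier k) → length (span v) ≡ 2 ^ k
  length-span {k} v = trans (LP.length-map (lin v) (allSubsets k)) (length-allSubsets k)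

  ≈[]-if-vanishes-on-span : ∀ {k} (v : Vec Carrier k) → LinIndep v → ∀ p → length p ≤ 2 ^ k →
                            (∀ S → eval p (lin v S) ≡ 0#) → p ≈ []
  ≈[]-if-vanishes-on-span {k} v indep p p≤2^k vanishes =
    many-roots⇒≈[] (span v) p (span-unique v indep) (AllP.map⁺ (All.tabulate λ {S} _ → vanishes S))
                   (subst (length p ≤_) (sym (length-span v)) p≤2^k)

  monic-add-monic : ∀ {d p q} → Monic d p → Monic d q → Σ (List Carrier) λ r → length r ≤ d × add p q ≈ r
  monic-add-monic (c , refl , refl) (c′ , c′≡c , refl) = add c c′ , ℕP.≤-reflexive length-c+c′ , (begin
    add (c ++ 1# ∷ []) (c′ ++ 1# ∷ [])    ≡⟨ add-++-++ c c′ 1# 1# (sym c′≡c) ⟩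
    add c c′ ++ (1# + 1#) ∷ []            ≡⟨ cong (λ z → add c c′ ++ z ∷ []) (x+x≡0 1#) ⟩
    add c c′ ++ 0# ∷ []                   ≈⟨ ++-0#-≈ (add c c′) ⟩
    add c c′                              ∎)
    where
      open ≈-Reasoning
      length-c+c′ : length (add c c′) ≡ length c
      length-c+c′ = trans (length-add c c′) (trans (cong (length c ⊔_) c′≡c) (ℕP.⊔-idem (length c)))

  -- In characteristic 2 the sum of two monic polynomials of degree 2^k has
  -- degree < 2^k, so it vanishes once it vanishes on 2^k points.
  monic-≈-if-agree-on-span : ∀ {k p q} (v : Vec Carrier k) → LinIndep v → Monic (2 ^ k) p → Monic (2 ^ k) q →
                             (∀ S → eval p (lin v S) ≡ eval q (lin v S)) → p ≈ q
  monic-≈-if-agree-on-span {k} {p} {q} v indep p-monic q-monic agree with monic-add-monic p-monic q-monic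
  ... | r , r≤2^k , p+q≈r = mk≈ λ j → x+y≡0⇒x≡y (trans (sym (coeff-add p q j)) (coeff-≡ p+q≈0 j))
    where
      p+q≈0 : add p q ≈ []
      p+q≈0 = ≈-trans p+q≈r (≈[]-if-vanishes-on-span v indep r r≤2^k λ S → begin
        eval r (lin v S)                            ≡⟨ eval-cong (lin v S) p+q≈r ⟨
        eval (add p q) (lin v S)                    ≡⟨ eval-add p q (lin v S) ⟩
        eval p (lin v S) + eval q (lin v S)         ≡⟨ cong (_+ eval q (lin v S)) (agree S) ⟩
        eval q (lin v S) + eval q (lin v S)         ≡⟨ x+x≡0 _ ⟩
        0#                                          ∎)
        where open ≡-Reasoning

  linearFactors : List Carrier → List Carrier
  linearFactors us = prod (map (λ u → u ∷ 1# ∷ []) us) (1# ∷ [])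

  linearFactors-monic : ∀ us → Monic (length us) (linearFactors us)
  linearFactors-monic us = subst (λ d → Monic d (linearFactors us)) (trans (ℕP.*-identityʳ _) (LP.length-map _ us))
    (monic-prod 1 (map (λ u → u ∷ 1# ∷ []) us) (AllP.map⁺ (All.tabulate λ {u} _ → (u ∷ []) , refl , refl)))

  linearFactors-root : ∀ {u us} → u ∈ us → eval (linearFactors us) u ≡ 0#
  linearFactors-root {u} {us} u∈us = begin
    eval (linearFactors us) u                                          ≡⟨ eval-prod (map (λ w → w ∷ 1# ∷ []) us) u ⟩
    product (map (λ p → eval p u) (map (λ w → w ∷ 1# ∷ []) us))        ≡⟨ product-zero (λ p → eval p u) (AnyP.map⁺ (Any.map (λ { refl → u+u≡0 }) u∈us)) ⟩
    0#                                                                 ∎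
    where
      open ≡-Reasoning
      u+u≡0 : eval (u ∷ 1# ∷ []) u ≡ 0#
      u+u≡0 = begin
        u + u * (1# + u * 0#)  ≡⟨ cong (λ z → u + u * (1# + z)) (zeroʳ u) ⟩
        u + u * (1# + 0#)      ≡⟨ cong (λ z → u + u * z) (+-identityʳ 1#) ⟩
        u + u * 1#             ≡⟨ cong (u +_) (*-identityʳ u) ⟩
        u + u                  ≡⟨ x+x≡0 u ⟩
        0#                     ∎

  subspacePoly : ∀ {k} → Vec Carrier k → List Carrier
  subspacePoly {k} v = prod (map (λ S → lin v S ∷ 1# ∷ []) (allSubsets k)) (1# ∷ [])

  subspacePoly≡linearFactors : ∀ {k} (v : Vec Carrier k) → subspacePoly v ≡ linearFactors (span v)
  subspacePoly≡linearFactors {k} v = cong (λ ps → prod ps (1# ∷ [])) (LP.map-∘ (allSubsets k))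

  subspacePoly-monic : ∀ {k} (v : Vec Carrier k) → Monic (2 ^ k) (subspacePoly v)
  subspacePoly-monic v = subst₂ Monic (length-span v) (sym (subspacePoly≡linearFactors v)) (linearFactors-monic (span v))

  subspacePoly-root : ∀ {k} (v : Vec Carrier k) S → eval (subspacePoly v) (lin v S) ≡ 0#
  subspacePoly-root {k} v S = trans (cong (λ p → eval p (lin v S)) (subspacePoly≡linearFactors v))
    (linearFactors-root (∈-map⁺ (lin v) (∈-allSubsets S)))

  IndepInKernel : List Bool → ∀ {j} → Vec Carrier j → Set
  IndepInKernel P v = LinIndep v × (∀ S → L P (lin v S) ≡ 0#)

  -- If P · (c ++ [1]) = X^n + 1 then the image of the linearized cofactor lies
  -- in ker L_P; a point outside the span of a partial basis is found as a
  -- non-root of ∏_S (L_cofactor(X) + lin v S), whose degree 2^(j + e) is < q.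
  module KernelBasis (P c : List Bool) (k : ℕ) (k+e≡n : k ℕ.+ length c ≡ n)
                     (P∘cofactor≡0 : ∀ x → L P (L (c ++ true ∷ []) x) ≡ 0#) where

    e : ℕ
    e = length c

    cofactor : List Bool
    cofactor = c ++ true ∷ []

    D : ∀ {j} → Vec Carrier j → List Carrier
    D {j} v = prod (map (λ S → add (lin v S ∷ []) (linPoly 0 cofactor)) (allSubsets j)) (1# ∷ [])

    D-monic : ∀ {j} (v : Vec Carrier j) → Monic (2 ^ (j ℕ.+ e)) (D v)
    D-monic {j} v = subst (λ d → Monic d (D v)) degree
      (monic-prod (2 ^ e) (map (λ S → add (lin v S ∷ []) (linPoly 0 cofactor)) (allSubsets j)) (AllP.map⁺ (All.tabulate λ {S} _ →
        monic-add-low (lin v S ∷ []) (ℕP.m^n>0 2 e) (linPoly-monic c 0))))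
      where
        degree : length (map (λ S → add (lin v S ∷ []) (linPoly 0 cofactor)) (allSubsets j)) ℕ.* 2 ^ e ≡ 2 ^ (j ℕ.+ e)
        degree = trans (cong (ℕ._* 2 ^ e) (trans (LP.length-map _ (allSubsets j)) (length-allSubsets j)))
                       (sym (ℕP.^-distribˡ-+-* 2 j e))

    eval-D : ∀ {j} (v : Vec Carrier j) x → eval (D v) x ≡ product (map (λ S → lin v S + L cofactor x) (allSubsets j))
    eval-D {j} v x = trans (eval-prod (map (λ S → add (lin v S ∷ []) (linPoly 0 cofactor)) (allSubsets j)) x) (cong product (trans (sym (LP.map-∘ (allSubsets j)))
      (LP.map-cong (λ S → trans (eval-add (lin v S ∷ []) (linPoly 0 cofactor) x)
                                (cong₂ _+_ (trans (cong (lin v S +_) (zeroʳ x)) (+-identityʳ _)) (eval-linPoly₀ cofactor x)))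
                   (allSubsets j))))

    non-root : ∀ {j} → j < k → (v : Vec Carrier j) → Σ Carrier λ x → eval (D v) x ≢ 0#
    non-root {j} j<k v with All.all? (λ x → eval (D v) x ≟ 0#) elements
    ... | no  ¬all = Any.satisfied (AllP.¬All⇒Any¬ (λ x → eval (D v) x ≟ 0#) elements ¬all)
    ... | yes all  = ⊥-elim (1≢0 (trans (sym (monic-leading (D-monic v))) (coeff-≡ D≈0 _)))
      where
        D-short : length (D v) ≤ length elements
        D-short = subst₂ _≤_ (sym (monic-length (D-monic v))) (sym length-elements)
                         (ℕP.^-monoʳ-< 2 (s≤s (s≤s z≤n)) (subst (j ℕ.+ e <_) k+e≡n (ℕP.+-monoˡ-< e j<k)))
        D≈0 : D v ≈ []
        D≈0 = many-roots⇒≈[] elements (D v) elements-unique all D-short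

    extend-basis : ∀ {j} → j < k → (v : Vec Carrier j) → IndepInKernel P v → Σ Carrier λ y → IndepInKernel P (y ∷ v)
    extend-basis {j} j<k v (indep , in-kernel) with non-root j<k v
    ... | x , Dx≢0 = y , indep′ , in-kernel′
      where
        y : Carrier
        y = L cofactor x
        indep′ : LinIndep (y ∷ v)
        indep′ (false ∷ S) vS≡0 = cong (false ∷_) (indep S (trans (sym (+-identityˡ _)) vS≡0))
        indep′ (true  ∷ S) y+vS≡0 = ⊥-elim (Dx≢0 (trans (eval-D v x)
          (product-zero _ (Any.map (λ { refl → trans (+-comm _ _) y+vS≡0 }) (∈-allSubsets S)))))
        in-kernel′ : ∀ S → L P (lin (y ∷ v) S) ≡ 0#
        in-kernel′ (s ∷ S) = begin
          L P ((if s then y else 0#) + lin v S)          ≡⟨ L-+ P _ (lin v S) ⟩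
          L P (if s then y else 0#) + L P (lin v S)      ≡⟨ cong₂ _+_ (y-part s) (in-kernel S) ⟩
          0# + 0#                                        ≡⟨ +-identityˡ 0# ⟩
          0#                                             ∎
          where
            open ≡-Reasoning
            y-part : ∀ s → L P (if s then y else 0#) ≡ 0#
            y-part true  = P∘cofactor≡0 x
            y-part false = L-0 P

    basis : ∀ j → j ≤ k → Σ (Vec Carrier j) (IndepInKernel P)
    basis zero    _     = [] , (λ { [] _ → refl }) , (λ { [] → L-0 P })
    basis (suc j) j<k with basis j (ℕP.<⇒≤ j<k)
    ... | v , v-ok with extend-basis j<k v v-ok
    ...   | y , y∷v-ok = y ∷ v , y∷v-ok

  kernel-basis : ∀ {k P} → F₂.Monic k P → 1 ≤ k → P ∣F2 XnPlus1 n → Σ (Vec Carrier k) (IndepInKernel P)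
  kernel-basis {k} {P} P-monic 1≤k (r , Pr≈) with cofactor-monic 1≤k 1≤n P-monic (F₂.mk≈ Pr≈)
  ... | c , r≈ , k+e≡n = KernelBasis.basis P c k k+e≡n P∘cofactor≡0 k ℕP.≤-refl
    where
      P∘cofactor≡0 : ∀ x → L P (L (c ++ true ∷ []) x) ≡ 0#
      P∘cofactor≡0 x = begin
        L P (L (c ++ true ∷ []) x)   ≡⟨ cong (L P) (L-cong x r≈) ⟨
        L P (L r x)                  ≡⟨ L-mul P r x ⟨
        L (F₂.mul P r) x             ≡⟨ L-cong {F₂.mul P r} {XnPlus1 n} x (F₂.mk≈ Pr≈) ⟩
        L (XnPlus1 n) x              ≡⟨ L-XnPlus1 x ⟩
        0#                           ∎
        where open ≡-Reasoning

  linPoly≈subspacePoly : ∀ {k P} (v : Vec Carrier k) → F₂.Monic k P → IndepInKernel P v → linPoly 0 P ≈ subspacePoly v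
  linPoly≈subspacePoly {k} v (cP , refl , refl) (indep , in-kernel) =
    monic-≈-if-agree-on-span v indep (linPoly-monic cP 0) (subspacePoly-monic v) λ S →
      trans (eval-linPoly₀ (cP ++ true ∷ []) (lin v S)) (trans (in-kernel S) (sym (subspacePoly-root v S)))

  ∣⇒splits : ∀ {k} (b : Fin (suc k) → Bool) → b (fromℕ k) ≡ true → 1 ≤ k → PF2 b ∣F2 XnPlus1 n → SplitsSimple b
  ∣⇒splits b b-top 1≤k P∣ with kernel-basis (PF2-monic b b-top) 1≤k P∣
  ... | v , v-ok = v , proj₁ v-ok ,
    coeff-≡ (subst (_≈ subspacePoly v) (sym (Lpoly≡linPoly b)) (linPoly≈subspacePoly v (PF2-monic b b-top) v-ok))

  splits⇒∣ : ∀ {k} (b : Fin (suc k) → Bool) → b (fromℕ k) ≡ true → SplitsSimple b → PF2 b ∣F2 XnPlus1 n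
  splits⇒∣ {k} b b-top (v , indep , Lpoly≈) with Division.divMod (PF2-monic b b-top) (XnPlus1 n)
  ... | Q , R , R≤k , X≈ = remainder-≈[]⇒∣ Q R X≈ (linPoly-≈[] 0 R linPoly-R≈0)
    where
      open Division (PF2-monic b b-top) using (remainder-≈[]⇒∣)
      P : List Bool
      P = PF2 b
      P-vanishes : ∀ S → L P (lin v S) ≡ 0#
      P-vanishes S = begin
        L P (lin v S)                        ≡⟨ eval-linPoly₀ P (lin v S) ⟨
        eval (linPoly 0 P) (lin v S)         ≡⟨ cong (λ p → eval p (lin v S)) (Lpoly≡linPoly b) ⟨
        eval (Lpoly b) (lin v S)             ≡⟨ eval-cong {Lpoly b} {subspacePoly v} (lin v S) (mk≈ Lpoly≈) ⟩
        eval (subspacePoly v) (lin v S)      ≡⟨ subspacePoly-root v S ⟩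
        0#                                   ∎
        where open ≡-Reasoning
      R-vanishes : ∀ S → eval (linPoly 0 R) (lin v S) ≡ 0#
      R-vanishes S = begin
        eval (linPoly 0 R) (lin v S)             ≡⟨ eval-linPoly₀ R u ⟩
        L R u                                    ≡⟨ +-identityˡ _ ⟨
        0# + L R u                               ≡⟨ cong (_+ L R u) PQ-vanishes ⟨
        L (F₂.mul P Q) u + L R u                 ≡⟨ L-add (F₂.mul P Q) R u ⟨
        L (F₂.add (F₂.mul P Q) R) u              ≡⟨ L-cong u X≈ ⟨
        L (XnPlus1 n) u                          ≡⟨ L-XnPlus1 u ⟩
        0#                                       ∎
        where
          open ≡-Reasoning
          u : Carrier
          u = lin v S
          PQ-vanishes : L (F₂.mul P Q) u ≡ 0#
          PQ-vanishes = trans (L-mul P Q u) (trans (L-comm P Q u) (trans (cong (L Q) (P-vanishes S)) (L-0 Q)))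
      linPoly-R≈0 : linPoly 0 R ≈ []
      linPoly-R≈0 = ≈[]-if-vanishes-on-span v indep (linPoly 0 R)
                      (ℕP.≤-trans (length-linPoly 0 R) (ℕP.^-monoʳ-≤ 2 R≤k)) R-vanishes

  coeff-linearFactors-0 : ∀ us → coeff (linearFactors us) 0 ≡ product us
  coeff-linearFactors-0 []       = refl
  coeff-linearFactors-0 (u ∷ us) = trans (coeff-X+u-mul-0 u (linearFactors us)) (cong (u *_) (coeff-linearFactors-0 us))

  coeff-linearFactors-1 : ∀ us → All (_≢ 0#) us → coeff (linearFactors us) 1 ≡ sumList (map Finv us) * product us
  coeff-linearFactors-1 []       []             = sym (zeroˡ 1#)
  coeff-linearFactors-1 (u ∷ us) (u≢0 ∷ us≢0) = begin
    coeff (linearFactors (u ∷ us)) 1        ≡⟨ coeff-X+u-mul-suc u (linearFactors us) 0 ⟩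
    u * G₁ + G₀                             ≡⟨ cong₂ (λ g₁ g₀ → u * g₁ + g₀) (coeff-linearFactors-1 us us≢0) (coeff-linearFactors-0 us) ⟩
    u * (σ * π) + π                         ≡⟨ cong (u * (σ * π) +_) (trans (cong (_* π) (x*Finv-x≡1 u u≢0)) (*-identityˡ π)) ⟨
    u * (σ * π) + u * Finv u * π            ≡⟨ regroup u (Finv u) σ π ⟩
    (Finv u + σ) * (u * π)                  ∎
    where
      open ≡-Reasoning
      G₀ G₁ σ π : Carrier
      G₀ = coeff (linearFactors us) 0
      G₁ = coeff (linearFactors us) 1
      σ = sumList (map Finv us)
      π = product us
      regroup : ∀ u u⁻¹ σ π → u * (σ * π) + u * u⁻¹ * π ≡ (u⁻¹ + σ) * (u * π)
      regroup = solve 4 (λ u u⁻¹ σ π → u :* (σ :* π) :+ u :* u⁻¹ :* π := (u⁻¹ :+ σ) :* (u :* π)) refl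

  span≡0∷nonzero : ∀ {k} (v : Vec Carrier k) → LinIndep v →
                   Σ (List Carrier) λ us → span v ≡ 0# ∷ us × All (_≢ 0#) us
  span≡0∷nonzero {k} v indep with allSubsets-head k | allSubsets-unique k
  ... | rest , subsets≡ | subsets-unique = map (lin v) rest , span≡ , AllP.map⁺ (All.map lin-nonzero 0∉rest)
    where
      span≡ : span v ≡ 0# ∷ map (lin v) rest
      span≡ = trans (cong (map (lin v)) subsets≡) (cong (_∷ map (lin v) rest) (lin-zero v))
      0∉rest : All (Vec.replicate k false ≢_) rest
      0∉rest with subst Unique subsets≡ subsets-unique
      ... | 0∉ ∷ _ = 0∉
      lin-nonzero : ∀ {S} → Vec.replicate k false ≢ S → lin v S ≢ 0#
      lin-nonzero 0≢S vS≡0 = 0≢S (sym (indep _ vS≡0))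

  -- Since 0 ∈ E, the coefficient of X² in ∏_{u ∈ E} (X + u) is that of X in ∏_{u ≠ 0} (X + u).
  Finv-sum-vanishes : 2 ≤ n → ∀ {k} (v : Vec Carrier k) → LinIndep v → coeff (subspacePoly v) 2 ≡ 0# → affineSum Finv 0# v ≡ 0#
  Finv-sum-vanishes 2≤n {k} v indep X²-coeff≡0 with span≡0∷nonzero v indep
  ... | us , span≡ , us≢0 = begin
    sumList (map (λ S → Finv (0# + lin v S)) (allSubsets k))  ≡⟨ cong sumList (LP.map-cong (λ S → cong Finv (+-identityˡ (lin v S))) (allSubsets k)) ⟩
    sumList (map (Finv ∘ lin v) (allSubsets k))               ≡⟨ cong sumList (trans (LP.map-∘ (allSubsets k)) (cong (map Finv) span≡)) ⟩
    Finv 0# + sumList (map Finv us)                           ≡⟨ cong₂ _+_ (Finv-0 2≤n) Σ≡0 ⟩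
    0# + 0#                                                   ≡⟨ +-identityˡ 0# ⟩
    0#                                                        ∎
    where
      open ≡-Reasoning
      Σ*Π≡0 : sumList (map Finv us) * product us ≡ 0#
      Σ*Π≡0 = begin
        sumList (map Finv us) * product us           ≡⟨ coeff-linearFactors-1 us us≢0 ⟨
        coeff (linearFactors us) 1                   ≡⟨ +-identityˡ _ ⟨
        0# + coeff (linearFactors us) 1              ≡⟨ cong (_+ coeff (linearFactors us) 1) (zeroˡ _) ⟨
        0# * coeff (linearFactors us) 2 + coeff (linearFactors us) 1 ≡⟨ coeff-X+u-mul-suc 0# (linearFactors us) 1 ⟨
        coeff (linearFactors (0# ∷ us)) 2            ≡⟨ cong (λ w → coeff (linearFactors w) 2) span≡ ⟨
        coeff (linearFactors (span v)) 2             ≡⟨ cong (λ p → coeff p 2) (subspacePoly≡linearFactors v) ⟨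
        coeff (subspacePoly v) 2                     ≡⟨ X²-coeff≡0 ⟩
        0#                                           ∎
      Σ≡0 : sumList (map Finv us) ≡ 0#
      Σ≡0 = [ id , (λ Π≡0 → ⊥-elim (product-nonzero id us≢0 (trans (cong product (LP.map-id us)) Π≡0))) ]′
              (zero-divisor _ _ Σ*Π≡0)

  splits⇒¬SumFree : ∀ {k} (a : Fin (suc (suc (suc k))) → Bool) → a (Fin.suc Fin.zero) ≡ false → 2 ≤ n →
                    SplitsSimple a → ¬ SumFree (suc (suc k)) Finv
  splits⇒¬SumFree a a₁≡false 2≤n (v , indep , Lpoly≈) sum-free =
    sum-free 0# v indep (Finv-sum-vanishes 2≤n v indep X²-coeff≡0)
    where
      X²-coeff≡0 : coeff (subspacePoly v) 2 ≡ 0#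
      X²-coeff≡0 = begin
        coeff (subspacePoly v) 2       ≡⟨ coeff-≡ (mk≈ {Lpoly a} {subspacePoly v} Lpoly≈) 2 ⟨
        coeff (Lpoly a) 2              ≡⟨ cong (λ p → coeff p 2) (Lpoly≡linPoly a) ⟩
        coeff (linPoly 0 (PF2 a)) 2    ≡⟨ coeff-linPoly-2 (a Fin.zero) (a (Fin.suc Fin.zero)) (toList (tabulate (a ∘ Fin.suc ∘ Fin.suc))) ⟩
        embed (a (Fin.suc Fin.zero))   ≡⟨ cong embed a₁≡false ⟩
        0#                             ∎
        where open ≡-Reasoning

  ∣⇒¬SumFree : ∀ {k} (a : Fin (suc (suc (suc k))) → Bool) → a (fromℕ (suc (suc k))) ≡ true → a (Fin.suc Fin.zero) ≡ false →
               PF2 a ∣F2 XnPlus1 n → ¬ SumFree (suc (suc k)) Finv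
  ∣⇒¬SumFree a a-top a₁≡false P∣ = splits⇒¬SumFree a a₁≡false 2≤n (∣⇒splits a a-top (s≤s z≤n) P∣)
    where
      2≤n : 2 ≤ n
      2≤n = ℕP.≤-trans (s≤s (s≤s z≤n)) (∣XnPlus1⇒deg≤ (s≤s z≤n) 1≤n (PF2-monic a a-top) P∣)

theorem2p1 : ((n k : ℕ) → 1 ≤ n → 1 ≤ k → (F : FiniteField n) →
               (b : Fin (suc k) → Bool) → b (fromℕ k) ≡ true →
               (InField.SplitsSimple F b ⇔ (powM (companion b) n ≡M idM))
               × ((powM (companion b) n ≡M idM) ⇔ (PF2 b ∣F2 XnPlus1 n)))
             × ((n k : ℕ) → 1 ≤ n → 1 ≤ k → (F : FiniteField n) →
               (a : Fin (suc k) → Bool) → a (fromℕ k) ≡ true →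
               ((i : Fin (suc k)) → toℕ i ≡ 1 → a i ≡ false) →
               PF2 a ∣F2 XnPlus1 n →
               ¬ InField.SumFree F k (InField.Finv F))
theorem2p1 = splitting , not-sum-free
  where
    splitting : (n k : ℕ) → 1 ≤ n → 1 ≤ k → (F : FiniteField n) →
                (b : Fin (suc k) → Bool) → b (fromℕ k) ≡ true →
                (InField.SplitsSimple F b ⇔ (powM (companion b) n ≡M idM))
                × ((powM (companion b) n ≡M idM) ⇔ (PF2 b ∣F2 XnPlus1 n))
    splitting n (suc k′) 1≤n _ F b b-top = ⇔-trans splits⇔∣ (⇔-sym A^n≡I⇔∣) , A^n≡I⇔∣
      where
        open Linearized F 1≤n using (∣⇒splits; splits⇒∣)
        splits⇔∣ : InField.SplitsSimple F b ⇔ (PF2 b ∣F2 XnPlus1 n)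
        splits⇔∣ = mk⇔ (splits⇒∣ b b-top) (∣⇒splits b b-top (s≤s z≤n))
        A^n≡I⇔∣ : (powM (companion b) n ≡M idM) ⇔ (PF2 b ∣F2 XnPlus1 n)
        A^n≡I⇔∣ = Companion.powM≡I⇔∣ b b-top n

    not-sum-free : (n k : ℕ) → 1 ≤ n → 1 ≤ k → (F : FiniteField n) →
                   (a : Fin (suc k) → Bool) → a (fromℕ k) ≡ true →
                   ((i : Fin (suc k)) → toℕ i ≡ 1 → a i ≡ false) →
                   PF2 a ∣F2 XnPlus1 n →
                   ¬ InField.SumFree F k (InField.Finv F)
    not-sum-free n (suc zero)    _   _ F a a-top a₁≡false _  = ⊥-elim (true≢false (trans (sym a-top) (a₁≡false _ refl)))
    not-sum-free n (suc (suc k)) 1≤n _ F a a-top a₁≡false P∣ = Linearized.∣⇒¬SumFree F 1≤n a a-top (a₁≡false _ refl) P∣
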